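{- Let $n\geq 2$ and $v\geq 2$ be integers, and let $\Gamma(n,v)$ be the graph defined below. Then $\mathrm{Aut}(\Gamma(n,v))$ is isomorphic to the wreath product $S_2\wr S_n\cong \mathbb{Z}_2^n\rtimes S_n$, of order $2^n n!$, if $v=2$; and to the dihedral group of order $2nv$ if $v\geq 3$.
   Context: The graph $\Gamma(n,v)$ has vertex set $\{(i,j):0\leq i\leq n-1,\ 0\leq j\leq v-1\}$, and $(i,j)$ is adjacent to $(k,\ell)$ if and only if one of the following holds: (1) $i=k$ and $j\neq \ell$; (2) $i<k$ and $\ell-j\not\equiv 0$ and $\ell-j\not\equiv 1 \pmod v$; (3) $i>k$ and $j-\ell\not\equiv 0$ and $j-\ell\not\equiv 1\pmod v$. -}

module Defs where

open import Data.Nat using (ℕ; _≤_)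
open import Data.Fin using (Fin; toℕ)
open import Data.Bool using (Bool; true; false; not; _xor_)
open import Data.Product using (_×_; _,_; proj₁; proj₂; Σ)
open import Data.Integer as ℤ using (ℤ; +_)
open import Data.Integer.Divisibility using (_∣_)
open import Relation.Binary.PropositionalEquality using (_≡_; subst₂; sym)
open import Relation.Nullary using (¬_)
open import Function.Bundles using (_↔_; Inverse)
open import Function.Construct.Composition using (_↔-∘_)
open import Function.Construct.Identity using (↔-id)
open import Function.Construct.Symmetry using (↔-sym)
open import Data.Fin.Permutation as P using (Permutation′; _⟨$⟩ʳ_; _⟨$⟩ˡ_; _∘ₚ_)
open import Algebra.Bundles.Raw using (RawGroup)
open import Algebra.Morphism.Structures using (module GroupMorphisms)
open import Level using (0ℓ)

Vertex : ℕ → ℕ → Set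
Vertex n v = Fin n × Fin v

zi : ∀ {v} → Fin v → ℤ
zi j = + toℕ j

_≡[_]_ : ℤ → ℕ → ℤ → Set
infix 4 _≡[_]_
x ≡[ v ] y = (+ v) ∣ (x ℤ.- y)

Adj : (n v : ℕ) → Vertex n v → Vertex n v → Set
Adj n v (i , j) (k , l) =
    (i ≡ k × ¬ (j ≡ l))
  Data.Sum.⊎ ((toℕ i Data.Nat.< toℕ k) × ¬ ((zi l ℤ.- zi j) ≡[ v ] + 0) × ¬ ((zi l ℤ.- zi j) ≡[ v ] + 1))
  Data.Sum.⊎ ((toℕ k Data.Nat.< toℕ i) × ¬ ((zi j ℤ.- zi l) ≡[ v ] + 0) × ¬ ((zi j ℤ.- zi l) ≡[ v ] + 1))
  where import Data.Sum; import Data.Nat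

record Automorphism (n v : ℕ) : Set where
  field
    bij      : Vertex n v ↔ Vertex n v
    preserve : ∀ x y → (Adj n v x y → Adj n v (Inverse.to bij x) (Inverse.to bij y))
                     × (Adj n v (Inverse.to bij x) (Inverse.to bij y) → Adj n v x y)
open Automorphism public

-- Automorphisms are composed as functions: (f ∙ g) x = f (g x)
AutGroup : ℕ → ℕ → RawGroup 0ℓ 0ℓ
AutGroup n v = record
  { Carrier = Automorphism n v
  ; _≈_     = λ f g → ∀ x → Inverse.to (bij f) x ≡ Inverse.to (bij g) x
  ; _∙_     = λ f g → record
      { bij = bij f ↔-∘ bij g
      ; preserve = λ x y →
          (λ a → proj₁ (preserve f _ _) (proj₁ (preserve g x y) a))
        , (λ a → proj₂ (preserve g x y) (proj₂ (preserve f _ _) a)) }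
  ; ε       = record { bij = ↔-id _ ; preserve = λ x y → (λ a → a) , (λ a → a) }
  ; _⁻¹     = λ f → record
      { bij = ↔-sym (bij f)
      ; preserve = λ x y →
          let e₁ = Inverse.strictlyInverseˡ (bij f) x
              e₂ = Inverse.strictlyInverseˡ (bij f) y
              fx = Inverse.from (bij f) x
              fy = Inverse.from (bij f) y in
          (λ a → proj₂ (preserve f fx fy) (subst₂ (Adj n v) (sym e₁) (sym e₂) a))
        , (λ a → subst₂ (Adj n v) e₁ e₂ (proj₁ (preserve f fx fy) a)) }
  }

-- Elements (f , σ), f : Fin n → Bool,
-- σ a permutation; (f,σ) is the signed permutation (i,b) ↦ (σ i, b xor f (σ i))
-- of Fin n × Bool, and the product is composition of these maps:
--   (f,σ)(g,τ) = (k ↦ f k xor g (σ⁻¹ k) , σ ∘ τ).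
-- Note: τ ∘ₚ σ means "first τ, then σ".

Wreath : ℕ → RawGroup 0ℓ 0ℓ
Wreath n = record
  { Carrier = (Fin n → Bool) × Permutation′ n
  ; _≈_     = λ { (f , σ) (g , τ) → (∀ i → f i ≡ g i) × (∀ i → σ ⟨$⟩ʳ i ≡ τ ⟨$⟩ʳ i) }
  ; _∙_     = λ { (f , σ) (g , τ) → (λ k → f k xor g (σ ⟨$⟩ˡ k)) , (τ ∘ₚ σ) }
  ; ε       = (λ _ → false) , P.id
  ; _⁻¹     = λ { (f , σ) → (λ k → f (σ ⟨$⟩ʳ k)) , P.flip σ }
  }

-- Dihedral group of order 2m:  ℤ_m ⋊ ℤ₂, elements (a , b) standing for
-- rᵃ sᵇ, with s r s⁻¹ = r⁻¹.  Rotation part taken in ℤ modulo m.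

Dihedral : ℕ → RawGroup 0ℓ 0ℓ
Dihedral m = record
  { Carrier = ℤ × Bool
  ; _≈_     = λ { (a , b) (c , d) → (a ≡[ m ] c) × (b ≡ d) }
  ; _∙_     = λ { (a , false) (c , d) → (a ℤ.+ c , d)
                ; (a , true)  (c , d) → (a ℤ.- c , not d) }
  ; ε       = (+ 0 , false)
  ; _⁻¹     = λ { (a , false) → (ℤ.- a , false)
                ; (a , true)  → (a , true) }
  }

_≅ᴳ_ : RawGroup 0ℓ 0ℓ → RawGroup 0ℓ 0ℓ → Set
G ≅ᴳ H = Σ (RawGroup.Carrier G → RawGroup.Carrier H)
             (GroupMorphisms.IsGroupIsomorphism G H)

-- The map ρ moving (i , j) down its column,
-- and the bottom vertex (n − 1 , j) to the top (0 , j − 1) of the previous column, runs through all nv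
-- vertices in a single cycle and is an automorphism, as is τ (i , j) = (n − 1 − i , − j).
-- For v ≥ 3 two vertices x, y are consecutive on this cycle iff they are distinct and non-adjacent, and
-- at most one vertex is non-adjacent or equal to x but adjacent to y. This is phrased through adjacency
-- alone, so every automorphism maps the cycle onto itself, keeping or reversing its direction; numbering
-- the vertices along the cycle it acts as t ↦ a ± t (mod nv), and (a , ±) identifies it with an element
-- of the dihedral group, every one of which is realised by ρ and τ.
-- For v = 2 the conditions on columns are void: Γ(n, 2) is the disjoint union of the n edges
-- {(i , 0), (i , 1)}, and an automorphism permutes these edges and flips some of them.

module Submission where

open import Defs

open import Algebra.Bundles.Raw using (RawGroup)
open import Data.Bool using (Bool; true; false; not; _xor_; _≟_)
import Data.Bool.Properties as BP
open import Data.Empty using (⊥; ⊥-elim)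
open import Data.Fin using (Fin; zero; suc; toℕ; fromℕ<; fromℕ; inject₁; opposite)
open import Data.Fin.Patterns using (0F; 1F)
open import Data.Fin.Permutation as P using (_⟨$⟩ʳ_; _⟨$⟩ˡ_)
import Data.Fin.Properties as FP
open import Data.Integer as ℤ using (ℤ; +_)
open import Data.Integer.DivMod using (_%ℕ_; _/ℕ_; a≡a%ℕn+[a/ℕn]*n)
import Data.Integer.Divisibility.Signed as ZS
import Data.Integer.Properties as ZP
open import Data.Integer.Solver using (module +-*-Solver)
open import Data.Nat using (ℕ; zero; suc; _≤_; _<_; _*_; _+_; _∸_; z≤n; s≤s; _<?_; NonZero)
import Data.Nat as ℕ
import Data.Nat.Divisibility as ND
open import Data.Nat.GeneralisedArithmetic using (fold; fold-+)
import Data.Nat.Properties as NP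
open import Data.Product using (_×_; _,_; proj₁; proj₂; Σ)
open import Data.Product.Properties using (≡-dec)
open import Data.Sum using (_⊎_; inj₁; inj₂; [_,_])
open import Function.Base using (_∘_)
open import Function.Bundles using (Inverse; mk↔ₛ′)
open import Level using (0ℓ)
open import Relation.Binary.Bundles using (Setoid)
open import Relation.Binary.Definitions using (tri<; tri≈; tri>)
open import Relation.Binary.PropositionalEquality hiding ([_])
import Relation.Binary.Reasoning.Setoid as SetoidReasoning
open import Relation.Nullary using (¬_; Dec; yes; no; does)
open import Relation.Nullary.Decidable using (_⊎-dec_; _×-dec_; decidable-stable; dec-true)

module _ {V : ℕ} where

  next : Fin (suc V) → Fin (suc V)
  next j with suc (toℕ j) <? suc V
  ... | yes p = fromℕ< p
  ... | no _  = zero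

  prev : Fin (suc V) → Fin (suc V)
  prev zero    = fromℕ V
  prev (suc j) = inject₁ j

  <last⊎≡last : (j : Fin (suc V)) → toℕ j < V ⊎ toℕ j ≡ V
  <last⊎≡last j = NP.m≤n⇒m<n∨m≡n (FP.toℕ≤pred[n] j)

  toℕ-next-< : (j : Fin (suc V)) → toℕ j < V → toℕ (next j) ≡ suc (toℕ j)
  toℕ-next-< j j<V with suc (toℕ j) <? suc V
  ... | yes p = FP.toℕ-fromℕ< p
  ... | no ¬p = ⊥-elim (¬p (s≤s j<V))

  next-last : (j : Fin (suc V)) → toℕ j ≡ V → next j ≡ zero
  next-last j j≡V with suc (toℕ j) <? suc V
  ... | yes (s≤s p) = ⊥-elim (NP.<-irrefl j≡V p)
  ... | no _        = refl

  toℕ-next : (j : Fin (suc V)) →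
             (toℕ j < V × toℕ (next j) ≡ suc (toℕ j)) ⊎ (toℕ j ≡ V × toℕ (next j) ≡ 0)
  toℕ-next j with <last⊎≡last j
  ... | inj₁ j<V = inj₁ (j<V , toℕ-next-< j j<V)
  ... | inj₂ j≡V = inj₂ (j≡V , cong toℕ (next-last j j≡V))

  toℕ-prev-zero : toℕ (prev zero) ≡ V
  toℕ-prev-zero = FP.toℕ-fromℕ V

  toℕ-prev-suc : (j : Fin (suc V)) {t : ℕ} → toℕ j ≡ suc t → toℕ (prev j) ≡ t
  toℕ-prev-suc (suc j) eq = trans (FP.toℕ-inject₁ j) (NP.suc-injective eq)

  next-prev : (j : Fin (suc V)) → next (prev j) ≡ j
  next-prev zero    = next-last (prev zero) toℕ-prev-zero
  next-prev (suc j) = FP.toℕ-injective (begin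
    toℕ (next (inject₁ j)) ≡⟨ toℕ-next-< (inject₁ j) inject₁j<V ⟩
    suc (toℕ (inject₁ j))  ≡⟨ cong suc (FP.toℕ-inject₁ j) ⟩
    toℕ (suc j)            ∎)
    where
    open ≡-Reasoning
    inject₁j<V : toℕ (inject₁ j) < V
    inject₁j<V = subst (_< V) (sym (FP.toℕ-inject₁ j)) (FP.toℕ<n j)

  prev-next : (j : Fin (suc V)) → prev (next j) ≡ j
  prev-next j with toℕ-next j
  ... | inj₁ (_ , eq)   = FP.toℕ-injective (toℕ-prev-suc (next j) eq)
  ... | inj₂ (j≡V , eq) = FP.toℕ-injective (begin
    toℕ (prev (next j)) ≡⟨ cong (toℕ ∘ prev) (FP.toℕ-injective {j = zero} eq) ⟩
    toℕ (prev zero)     ≡⟨ toℕ-prev-zero ⟩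
    V                   ≡⟨ sym j≡V ⟩
    toℕ j               ∎)
    where open ≡-Reasoning

  next-irrefl : 1 ≤ V → (j : Fin (suc V)) → next j ≢ j
  next-irrefl 1≤V j eq with toℕ-next j
  ... | inj₁ (_ , t)   = NP.1+n≢n (trans (sym t) (cong toℕ eq))
  ... | inj₂ (j≡V , t) = NP.n>0⇒n≢0 1≤V (trans (sym j≡V) (trans (sym (cong toℕ eq)) t))

  next²-irrefl : 2 ≤ V → (j : Fin (suc V)) → next (next j) ≢ j
  next²-irrefl 2≤V j eq with toℕ-next j | toℕ-next (next j)
  ... | inj₁ (_ , t) | inj₁ (_ , t′) =
    NP.m+1+n≢n 1 (trans (sym (trans t′ (cong suc t))) (cong toℕ eq))
  ... | inj₁ (_ , t) | inj₂ (next-j≡V , t′) =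
    NP.>⇒≢ 2≤V (trans (sym next-j≡V) (trans t (cong suc (trans (sym (cong toℕ eq)) t′))))
  ... | inj₂ (j≡V , t) | inj₁ (_ , t′) =
    NP.>⇒≢ 2≤V (trans (sym j≡V) (trans (sym (cong toℕ eq)) (trans t′ (cong suc t))))
  ... | inj₂ (j≡V , t) | inj₂ (next-j≡V , _) =
    NP.n>0⇒n≢0 (NP.<⇒≤ 2≤V) (trans (sym next-j≡V) t)

  negate : Fin (suc V) → Fin (suc V)
  negate zero    = zero
  negate (suc j) = suc (opposite j)

  negate-involutive : (j : Fin (suc V)) → negate (negate j) ≡ j
  negate-involutive zero    = refl
  negate-involutive (suc j) = cong suc (FP.opposite-involutive j)

  toℕ-negate-suc : (j : Fin (suc V)) {t : ℕ} → toℕ j ≡ suc t → toℕ (negate j) ≡ V ∸ t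
  toℕ-negate-suc (suc j) {t} eq = begin
    suc (toℕ (opposite j)) ≡⟨ cong suc (FP.opposite-prop j) ⟩
    suc (V ∸ suc (toℕ j))  ≡⟨ NP.+-∸-assoc 1 (FP.toℕ<n j) ⟨
    V ∸ toℕ j              ≡⟨ cong (V ∸_) (NP.suc-injective eq) ⟩
    V ∸ t                  ∎
    where open ≡-Reasoning

  next-negate-next : 1 ≤ V → (j : Fin (suc V)) → next (negate (next j)) ≡ negate j
  next-negate-next 1≤V j with toℕ-next j
  next-negate-next 1≤V zero    | inj₁ (_ , t) = next-last _ (toℕ-negate-suc (next zero) t)
  next-negate-next 1≤V (suc j) | inj₁ (j<V , t) = FP.toℕ-injective (begin
    toℕ (next (negate (next (suc j)))) ≡⟨ toℕ-next-< _ (subst (_< V) (sym −j−1) −j−1<V) ⟩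
    suc (toℕ (negate (next (suc j))))  ≡⟨ cong suc −j−1 ⟩
    suc (V ∸ suc (toℕ j))              ≡⟨ NP.+-∸-assoc 1 (NP.<⇒≤ j<V) ⟨
    V ∸ toℕ j                          ≡⟨ toℕ-negate-suc (suc j) refl ⟨
    toℕ (negate (suc j))               ∎)
    where
    open ≡-Reasoning
    −j−1 : toℕ (negate (next (suc j))) ≡ V ∸ suc (toℕ j)
    −j−1 = toℕ-negate-suc (next (suc j)) t
    −j−1<V : V ∸ suc (toℕ j) < V
    −j−1<V = NP.∸-monoʳ-< {o = 0} (s≤s z≤n) (NP.<⇒≤ j<V)
  next-negate-next 1≤V zero    | inj₂ (0≡V , _) = ⊥-elim (NP.n>0⇒n≢0 1≤V (sym 0≡V))
  next-negate-next 1≤V (suc j) | inj₂ (j≡V , t) = FP.toℕ-injective (begin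
    toℕ (next (negate (next (suc j)))) ≡⟨ cong (toℕ ∘ next ∘ negate) (FP.toℕ-injective {j = zero} t) ⟩
    toℕ (next (zero {V}))              ≡⟨ toℕ-next-< zero 1≤V ⟩
    1                                  ≡⟨ NP.m+n∸n≡m 1 (toℕ j) ⟨
    suc (toℕ j) ∸ toℕ j                ≡⟨ cong (_∸ toℕ j) j≡V ⟩
    V ∸ toℕ j                          ≡⟨ toℕ-negate-suc (suc j) refl ⟨
    toℕ (negate (suc j))               ∎)
    where open ≡-Reasoning

  Step : Fin (suc V) → Fin (suc V) → Set
  Step j l = l ≡ j ⊎ l ≡ next j

  step? : (j l : Fin (suc V)) → Dec (Step j l)
  step? j l = (l FP.≟ j) ⊎-dec (l FP.≟ next j)

  Step-prev : {j l : Fin (suc V)} → Step j l → Step (prev l) j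
  Step-prev {j} {l} (inj₁ l≡j)      = inj₂ (trans (sym l≡j) (sym (next-prev l)))
  Step-prev {j} {l} (inj₂ l≡next-j) = inj₁ (trans (sym (prev-next j)) (cong prev (sym l≡next-j)))

  Step-negate : 1 ≤ V → {j l : Fin (suc V)} → Step j l → Step (negate l) (negate j)
  Step-negate _   (inj₁ l≡j)      = inj₁ (cong negate (sym l≡j))
  Step-negate 1≤V {j} (inj₂ l≡next-j) =
    inj₂ (trans (sym (next-negate-next 1≤V j)) (cong (next ∘ negate) (sym l≡next-j)))

  ¬Step-back : 2 ≤ V → (j : Fin (suc V)) → ¬ Step (next j) j
  ¬Step-back 2≤V j (inj₁ j≡next-j)  = next-irrefl (NP.<⇒≤ 2≤V) j (sym j≡next-j)
  ¬Step-back 2≤V j (inj₂ j≡next²-j) = next²-irrefl 2≤V j (sym j≡next²-j)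

  ¬Step-by-two : 2 ≤ V → (j : Fin (suc V)) → ¬ Step j (next (next j))
  ¬Step-by-two 2≤V j (inj₁ next²-j≡j)      = next²-irrefl 2≤V j next²-j≡j
  ¬Step-by-two 2≤V j (inj₂ next²-j≡next-j) = next-irrefl (NP.<⇒≤ 2≤V) (next j) next²-j≡next-j

  ¬Step-prev-next : 2 ≤ V → (j : Fin (suc V)) → ¬ Step (prev j) (next j)
  ¬Step-prev-next 2≤V j = subst (λ u → ¬ Step (prev j) (next u)) (next-prev j) (¬Step-by-two 2≤V (prev j))

∣m-n∣<o : ∀ {o} m n → m < o → n < o → ℕ.∣ m - n ∣ < o
∣m-n∣<o zero    n       _   n<o = n<o
∣m-n∣<o (suc m) zero    m<o _   = m<o
∣m-n∣<o (suc m) (suc n) m<o n<o = ∣m-n∣<o m n (NP.<-trans (NP.n<1+n m) m<o) (NP.<-trans (NP.n<1+n n) n<o)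

o≤∣m-n∣⇒m≡0∧n≡o : ∀ {o} m n → m < o → n ≤ o → o ≤ ℕ.∣ m - n ∣ → m ≡ 0 × n ≡ o
o≤∣m-n∣⇒m≡0∧n≡o zero    n       _   n≤o o≤n = refl , NP.≤-antisym n≤o o≤n
o≤∣m-n∣⇒m≡0∧n≡o (suc m) zero    m<o _   o≤m = ⊥-elim (NP.<⇒≱ m<o o≤m)
o≤∣m-n∣⇒m≡0∧n≡o (suc m) (suc n) m<o n≤o o≤∣m-n∣
  with o≤∣m-n∣⇒m≡0∧n≡o m n (NP.<-trans (NP.n<1+n m) m<o) (NP.≤-trans (NP.n≤1+n n) n≤o) o≤∣m-n∣
... | _ , refl = ⊥-elim (NP.<-irrefl refl n≤o)

o∣n<o⇒n≡0 : ∀ {o n} → o ND.∣ n → n < o → n ≡ 0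
o∣n<o⇒n≡0 {n = zero}  _   _   = refl
o∣n<o⇒n≡0 {n = suc n} o∣n n<o = ⊥-elim (ND.>⇒∤ n<o o∣n)

∣+m-+n∣≡∣m-n∣ : ∀ m n → ℤ.∣ + m ℤ.- + n ∣ ≡ ℕ.∣ m - n ∣
∣+m-+n∣≡∣m-n∣ m n = trans (cong ℤ.∣_∣ (ZP.m-n≡m⊖n m n)) (∣m⊖n∣≡∣m-n∣ (NP.≤-total m n))
  where
  open ≡-Reasoning
  ∣m⊖n∣≡∣m-n∣ : m ≤ n ⊎ n ≤ m → ℤ.∣ m ℤ.⊖ n ∣ ≡ ℕ.∣ m - n ∣
  ∣m⊖n∣≡∣m-n∣ (inj₁ m≤n) = begin
    ℤ.∣ m ℤ.⊖ n ∣ ≡⟨ ZP.∣⊖∣-≤ m≤n ⟩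
    n ∸ m         ≡⟨ NP.m≤n⇒∣m-n∣≡n∸m m≤n ⟨
    ℕ.∣ m - n ∣   ∎
  ∣m⊖n∣≡∣m-n∣ (inj₂ n≤m) = begin
    ℤ.∣ m ℤ.⊖ n ∣ ≡⟨ ZP.∣m⊖n∣≡∣n⊖m∣ m n ⟩
    ℤ.∣ n ℤ.⊖ m ∣ ≡⟨ ZP.∣⊖∣-≤ n≤m ⟩
    m ∸ n         ≡⟨ NP.m≤n⇒∣n-m∣≡n∸m n≤m ⟨
    ℕ.∣ m - n ∣   ∎

module _ {V : ℕ} (j l : Fin (suc V)) where
  open +-*-Solver using (solve; _:+_; _:-_; :-_; _:=_; con)

  private
    ∣offset∣ : ℤ.∣ (zi l ℤ.- zi j) ℤ.- + 0 ∣ ≡ ℕ.∣ toℕ l - toℕ j ∣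
    ∣offset∣ = trans (cong ℤ.∣_∣ (ZP.+-identityʳ (zi l ℤ.- zi j))) (∣+m-+n∣≡∣m-n∣ (toℕ l) (toℕ j))

    ∣offset-1∣ : ℤ.∣ (zi l ℤ.- zi j) ℤ.- + 1 ∣ ≡ ℕ.∣ toℕ l - suc (toℕ j) ∣
    ∣offset-1∣ = trans (cong ℤ.∣_∣ l-j-1≡l-[1+j]) (∣+m-+n∣≡∣m-n∣ (toℕ l) (suc (toℕ j)))
      where
      l-j-1≡l-[1+j] : (zi l ℤ.- zi j) ℤ.- + 1 ≡ zi l ℤ.- + suc (toℕ j)
      l-j-1≡l-[1+j] = solve 2 (λ a b → (a :- b) :- con (+ 1) := a :- (con (+ 1) :+ b)) refl (zi l) (zi j)

  offset≡0⇒≡ : (zi l ℤ.- zi j) ≡[ suc V ] + 0 → l ≡ j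
  offset≡0⇒≡ v∣offset = FP.toℕ-injective (NP.∣m-n∣≡0⇒m≡n
    (o∣n<o⇒n≡0 (subst (suc V ND.∣_) ∣offset∣ v∣offset) (∣m-n∣<o _ _ (FP.toℕ<n l) (FP.toℕ<n j))))

  ≡⇒offset≡0 : l ≡ j → (zi l ℤ.- zi j) ≡[ suc V ] + 0
  ≡⇒offset≡0 refl = subst (suc V ND.∣_) (sym (trans ∣offset∣ (NP.∣n-n∣≡0 (toℕ l)))) (suc V ND.∣0)

  offset≡1⇒≡next : (zi l ℤ.- zi j) ≡[ suc V ] + 1 → l ≡ next j
  offset≡1⇒≡next v∣offset with ℕ.∣ toℕ l - suc (toℕ j) ∣ in eq
  ... | zero = FP.toℕ-injective (trans l≡1+j (sym (toℕ-next-< j j<V)))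
    where
    l≡1+j : toℕ l ≡ suc (toℕ j)
    l≡1+j = NP.∣m-n∣≡0⇒m≡n eq
    j<V : toℕ j < V
    j<V = NP.<-pred (subst (_< suc V) l≡1+j (FP.toℕ<n l))
  ... | suc _ = FP.toℕ-injective (trans l≡0 (sym (cong toℕ (next-last j (NP.suc-injective 1+j≡v)))))
    where
    v≤∣l-1-j∣ : suc V ≤ ℕ.∣ toℕ l - suc (toℕ j) ∣
    v≤∣l-1-j∣ = subst (suc V ≤_) (sym eq)
                      (ND.∣⇒≤ (subst (suc V ND.∣_) (trans ∣offset-1∣ eq) v∣offset))
    l≡0∧1+j≡v : toℕ l ≡ 0 × suc (toℕ j) ≡ suc V
    l≡0∧1+j≡v = o≤∣m-n∣⇒m≡0∧n≡o (toℕ l) (suc (toℕ j)) (FP.toℕ<n l) (FP.toℕ<n j) v≤∣l-1-j∣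
    l≡0 : toℕ l ≡ 0
    l≡0 = proj₁ l≡0∧1+j≡v
    1+j≡v : suc (toℕ j) ≡ suc V
    1+j≡v = proj₂ l≡0∧1+j≡v

  ≡next⇒offset≡1 : l ≡ next j → (zi l ℤ.- zi j) ≡[ suc V ] + 1
  ≡next⇒offset≡1 refl = subst (suc V ND.∣_) (sym ∣offset-1∣) v∣∣next-j-1-j∣
    where
    v∣∣next-j-1-j∣ : suc V ND.∣ ℕ.∣ toℕ (next j) - suc (toℕ j) ∣
    v∣∣next-j-1-j∣ with toℕ-next j
    ... | inj₁ (_ , t)   = subst (suc V ND.∣_) (sym (NP.m≡n⇒∣m-n∣≡0 t)) (suc V ND.∣0)
    ... | inj₂ (j≡V , t) = subst (λ x → suc V ND.∣ ℕ.∣ x - suc (toℕ j) ∣) (sym t)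
                                 (subst (λ y → suc V ND.∣ suc y) (sym j≡V) ND.∣-refl)

module _ {n V : ℕ} where

  NonAdj : Vertex n (suc V) → Vertex n (suc V) → Set
  NonAdj (i , j) (k , l) = (i ≡ k × j ≡ l)
                         ⊎ (toℕ i < toℕ k × Step j l)
                         ⊎ (toℕ k < toℕ i × Step l j)

  NonAdj? : (x y : Vertex n (suc V)) → Dec (NonAdj x y)
  NonAdj? (i , j) (k , l) = ((i FP.≟ k) ×-dec (j FP.≟ l))
                       ⊎-dec ((toℕ i <? toℕ k) ×-dec step? j l)
                       ⊎-dec ((toℕ k <? toℕ i) ×-dec step? l j)

  NonAdj⇒¬Adj : ∀ x y → NonAdj x y → ¬ Adj n (suc V) x y
  NonAdj⇒¬Adj _ _ (inj₁ (refl , refl)) (inj₁ (_ , j≢j))              = j≢j refl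
  NonAdj⇒¬Adj _ _ (inj₁ (refl , refl)) (inj₂ (inj₁ (i<i , _)))       = NP.<-irrefl refl i<i
  NonAdj⇒¬Adj _ _ (inj₁ (refl , refl)) (inj₂ (inj₂ (i<i , _)))       = NP.<-irrefl refl i<i
  NonAdj⇒¬Adj _ _ (inj₂ (inj₁ (i<i , _))) (inj₁ (refl , _))          = NP.<-irrefl refl i<i
  NonAdj⇒¬Adj _ _ (inj₂ (inj₂ (i<i , _))) (inj₁ (refl , _))          = NP.<-irrefl refl i<i
  NonAdj⇒¬Adj _ _ (inj₂ (inj₁ (i<k , _))) (inj₂ (inj₂ (k<i , _)))    = NP.<-asym i<k k<i
  NonAdj⇒¬Adj _ _ (inj₂ (inj₂ (k<i , _))) (inj₂ (inj₁ (i<k , _)))    = NP.<-asym i<k k<i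
  NonAdj⇒¬Adj (_ , j) (_ , l) (inj₂ (inj₁ (_ , step))) (inj₂ (inj₁ (_ , ¬0 , ¬1))) =
    [ ¬0 ∘ ≡⇒offset≡0 j l , ¬1 ∘ ≡next⇒offset≡1 j l ] step
  NonAdj⇒¬Adj (_ , j) (_ , l) (inj₂ (inj₂ (_ , step))) (inj₂ (inj₂ (_ , ¬0 , ¬1))) =
    [ ¬0 ∘ ≡⇒offset≡0 l j , ¬1 ∘ ≡next⇒offset≡1 l j ] step

  ¬NonAdj⇒Adj : ∀ x y → ¬ NonAdj x y → Adj n (suc V) x y
  ¬NonAdj⇒Adj (i , j) (k , l) ¬nonAdj with NP.<-cmp (toℕ i) (toℕ k)
  ... | tri< i<k _ _ = inj₂ (inj₁ (i<k , ¬nonAdj ∘ inj₂ ∘ inj₁ ∘ (i<k ,_) ∘ inj₁ ∘ offset≡0⇒≡ j l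
                                       , ¬nonAdj ∘ inj₂ ∘ inj₁ ∘ (i<k ,_) ∘ inj₂ ∘ offset≡1⇒≡next j l))
  ... | tri≈ _ i≡k _ = inj₁ (FP.toℕ-injective i≡k , ¬nonAdj ∘ inj₁ ∘ (FP.toℕ-injective i≡k ,_))
  ... | tri> _ _ k<i = inj₂ (inj₂ (k<i , ¬nonAdj ∘ inj₂ ∘ inj₂ ∘ (k<i ,_) ∘ inj₁ ∘ offset≡0⇒≡ l j
                                       , ¬nonAdj ∘ inj₂ ∘ inj₂ ∘ (k<i ,_) ∘ inj₂ ∘ offset≡1⇒≡next l j))

  ¬Adj⇒NonAdj : ∀ x y → ¬ Adj n (suc V) x y → NonAdj x y
  ¬Adj⇒NonAdj x y ¬adj = decidable-stable (NonAdj? x y) (¬adj ∘ ¬NonAdj⇒Adj x y)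

module _ {n v : ℕ} where

  ⟦_⟧ : Automorphism n v → Vertex n v → Vertex n v
  ⟦ φ ⟧ = Inverse.to (bij φ)

  ⟦_⟧⁻¹ : Automorphism n v → Vertex n v → Vertex n v
  ⟦ φ ⟧⁻¹ = Inverse.from (bij φ)

  ⟦⟧-inverseˡ : (φ : Automorphism n v) (x : Vertex n v) → ⟦ φ ⟧ (⟦ φ ⟧⁻¹ x) ≡ x
  ⟦⟧-inverseˡ φ = Inverse.strictlyInverseˡ (bij φ)

  ⟦⟧-inverseʳ : (φ : Automorphism n v) (x : Vertex n v) → ⟦ φ ⟧⁻¹ (⟦ φ ⟧ x) ≡ x
  ⟦⟧-inverseʳ φ = Inverse.strictlyInverseʳ (bij φ)

  ⟦⟧-injective : (φ : Automorphism n v) {x y : Vertex n v} → ⟦ φ ⟧ x ≡ ⟦ φ ⟧ y → x ≡ y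
  ⟦⟧-injective φ {x} {y} eq = trans (sym (⟦⟧-inverseʳ φ x)) (trans (cong ⟦ φ ⟧⁻¹ eq) (⟦⟧-inverseʳ φ y))

module _ {n V : ℕ} where

  NonAdj-preserved : (φ : Automorphism n (suc V)) → ∀ x y → NonAdj x y → NonAdj (⟦ φ ⟧ x) (⟦ φ ⟧ y)
  NonAdj-preserved φ x y nonAdj = ¬Adj⇒NonAdj _ _ (NonAdj⇒¬Adj x y nonAdj ∘ proj₂ (preserve φ x y))

  NonAdj-reflected : (φ : Automorphism n (suc V)) → ∀ x y → NonAdj (⟦ φ ⟧ x) (⟦ φ ⟧ y) → NonAdj x y
  NonAdj-reflected φ x y nonAdj = ¬Adj⇒NonAdj _ _ (NonAdj⇒¬Adj _ _ nonAdj ∘ proj₁ (preserve φ x y))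

  automorphism : (f g : Vertex n (suc V) → Vertex n (suc V)) →
                 (∀ x → f (g x) ≡ x) → (∀ x → g (f x) ≡ x) →
                 (∀ x y → NonAdj x y → NonAdj (f x) (f y)) →
                 (∀ x y → NonAdj x y → NonAdj (g x) (g y)) →
                 Automorphism n (suc V)
  automorphism f g f∘g g∘f f-nonAdj g-nonAdj = record
    { bij      = mk↔ₛ′ f g f∘g g∘f
    ; preserve = λ x y →
        (λ adj → ¬NonAdj⇒Adj _ _ λ nonAdj →
           NonAdj⇒¬Adj x y (subst₂ NonAdj (g∘f x) (g∘f y) (g-nonAdj _ _ nonAdj)) adj)
      , (λ adj → ¬NonAdj⇒Adj _ _ λ nonAdj → NonAdj⇒¬Adj _ _ (f-nonAdj _ _ nonAdj) adj) }

module Symmetries (N V : ℕ) (1≤V : 1 ≤ V) where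

  Vtx : Set
  Vtx = Vertex (suc N) (suc V)

  ρ : Vtx → Vtx
  ρ (i , j) with toℕ i ℕ.≟ N
  ... | yes _ = zero , prev j
  ... | no _  = next i , j

  ρ-<last : ∀ i j → toℕ i < N → ρ (i , j) ≡ (next i , j)
  ρ-<last i j i<N with toℕ i ℕ.≟ N
  ... | yes i≡N = ⊥-elim (NP.<-irrefl i≡N i<N)
  ... | no _    = refl

  ρ-last : ∀ i j → toℕ i ≡ N → ρ (i , j) ≡ (zero , prev j)
  ρ-last i j i≡N with toℕ i ℕ.≟ N
  ... | yes _   = refl
  ... | no i≢N  = ⊥-elim (i≢N i≡N)

  ρ⁻¹ : Vtx → Vtx
  ρ⁻¹ (zero  , j) = prev zero , next j
  ρ⁻¹ (suc i , j) = prev (suc i) , j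

  ρ⁻¹-suc : ∀ i j {t} → toℕ i ≡ suc t → ρ⁻¹ (i , j) ≡ (prev i , j)
  ρ⁻¹-suc (suc i) j _ = refl

  vertex-≡ : {i k : Fin (suc N)} {j l : Fin (suc V)} → toℕ i ≡ toℕ k → j ≡ l → (i , j) ≡ (k , l)
  vertex-≡ i≡k refl = cong (_, _) (FP.toℕ-injective i≡k)

  ρ⁻¹∘ρ : ∀ x → ρ⁻¹ (ρ x) ≡ x
  ρ⁻¹∘ρ (i , j) with <last⊎≡last i
  ... | inj₁ i<N = trans (cong ρ⁻¹ (ρ-<last i j i<N))
                         (trans (ρ⁻¹-suc (next i) j (toℕ-next-< i i<N)) (cong (_, j) (prev-next i)))
  ... | inj₂ i≡N = trans (cong ρ⁻¹ (ρ-last i j i≡N)) (vertex-≡ (trans toℕ-prev-zero (sym i≡N)) (next-prev j))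

  ρ∘ρ⁻¹ : ∀ x → ρ (ρ⁻¹ x) ≡ x
  ρ∘ρ⁻¹ (zero , j)  = trans (ρ-last (prev zero) (next j) toℕ-prev-zero) (cong (zero ,_) (prev-next j))
  ρ∘ρ⁻¹ (suc i , j) = trans (ρ-<last (prev (suc i)) j (subst (_< N) (sym (FP.toℕ-inject₁ i)) (FP.toℕ<n i)))
                            (cong (_, j) (next-prev (suc i)))

  τ : Vtx → Vtx
  τ (i , j) = opposite i , negate j

  τ-involutive : ∀ x → τ (τ x) ≡ x
  τ-involutive (i , j) = cong₂ _,_ (FP.opposite-involutive i) (negate-involutive j)

  toℕ-opposite : (i : Fin (suc N)) → toℕ (opposite i) ≡ N ∸ toℕ i
  toℕ-opposite = FP.opposite-prop

  opposite-< : (i k : Fin (suc N)) → toℕ i < toℕ k → toℕ (opposite k) < toℕ (opposite i)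
  opposite-< i k i<k = subst₂ _<_ (sym (toℕ-opposite k)) (sym (toℕ-opposite i))
                                  (NP.∸-monoʳ-< i<k (FP.toℕ≤pred[n] k))

  ρ⁻¹≡τ∘ρ∘τ : ∀ x → ρ⁻¹ x ≡ τ (ρ (τ x))
  ρ⁻¹≡τ∘ρ∘τ (zero , j) = sym (trans (cong τ (ρ-last (opposite zero) (negate j) (toℕ-opposite zero)))
                                    (vertex-≡ refl −[−j−1]≡j+1))
    where
    −[−j−1]≡j+1 : negate (prev (negate j)) ≡ next j
    −[−j−1]≡j+1 = begin
      negate (prev (negate j))                     ≡⟨ cong (negate ∘ prev) (next-negate-next 1≤V j) ⟨
      negate (prev (next (negate (next j))))       ≡⟨ cong negate (prev-next (negate (next j))) ⟩
      negate (negate (next j))                     ≡⟨ negate-involutive (next j) ⟩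
      next j                                       ∎
      where open ≡-Reasoning
  ρ⁻¹≡τ∘ρ∘τ (suc i , j) = sym (trans (cong τ (ρ-<last (opposite (suc i)) (negate j) opp<N))
                                     (vertex-≡ N−[N−i−1+1]≡i (negate-involutive j)))
    where
    i+1≤N : suc (toℕ i) ≤ N
    i+1≤N = FP.toℕ≤pred[n] (suc i)
    opp<N : toℕ (opposite (suc i)) < N
    opp<N = subst (_< N) (sym (toℕ-opposite (suc i))) (NP.∸-monoʳ-< {o = 0} (s≤s z≤n) i+1≤N)
    N−[N−i−1+1]≡i : toℕ (opposite (next (opposite (suc i)))) ≡ toℕ (prev (suc i))
    N−[N−i−1+1]≡i = begin
      toℕ (opposite (next (opposite (suc i)))) ≡⟨ toℕ-opposite (next (opposite (suc i))) ⟩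
      N ∸ toℕ (next (opposite (suc i)))        ≡⟨ cong (N ∸_) (toℕ-next-< _ opp<N) ⟩
      N ∸ suc (toℕ (opposite (suc i)))         ≡⟨ cong (λ u → N ∸ suc u) (toℕ-opposite (suc i)) ⟩
      N ∸ suc (N ∸ suc (toℕ i))                ≡⟨ cong (N ∸_) (NP.+-∸-assoc 1 i+1≤N) ⟨
      N ∸ (N ∸ toℕ i)                          ≡⟨ NP.m∸[m∸n]≡n (NP.<⇒≤ i+1≤N) ⟩
      toℕ i                                    ≡⟨ FP.toℕ-inject₁ i ⟨
      toℕ (prev (suc i))                       ∎
      where open ≡-Reasoning

  ρ≡τ∘ρ⁻¹∘τ : ∀ x → ρ x ≡ τ (ρ⁻¹ (τ x))
  ρ≡τ∘ρ⁻¹∘τ x = begin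
    ρ x                 ≡⟨ τ-involutive (ρ x) ⟨
    τ (τ (ρ x))         ≡⟨ cong (τ ∘ τ ∘ ρ) (τ-involutive x) ⟨
    τ (τ (ρ (τ (τ x)))) ≡⟨ cong τ (ρ⁻¹≡τ∘ρ∘τ (τ x)) ⟨
    τ (ρ⁻¹ (τ x))       ∎
    where open ≡-Reasoning

  ρ-NonAdj : ∀ x y → NonAdj x y → NonAdj (ρ x) (ρ y)
  ρ-NonAdj _ _ (inj₁ (refl , refl)) = inj₁ (refl , refl)
  ρ-NonAdj (i , j) (k , l) (inj₂ (inj₁ (i<k , step))) with <last⊎≡last i | <last⊎≡last k
  ... | inj₂ i≡N | _       = ⊥-elim (NP.<⇒≱ i<k (subst (_ ≤_) (sym i≡N) (FP.toℕ≤pred[n] k)))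
  ... | inj₁ i<N | inj₁ k<N = subst₂ NonAdj (sym (ρ-<last i j i<N)) (sym (ρ-<last k l k<N))
    (inj₂ (inj₁ (subst₂ _<_ (sym (toℕ-next-< i i<N)) (sym (toℕ-next-< k k<N)) (s≤s i<k) , step)))
  ... | inj₁ i<N | inj₂ k≡N = subst₂ NonAdj (sym (ρ-<last i j i<N)) (sym (ρ-last k l k≡N))
    (inj₂ (inj₂ (subst (0 <_) (sym (toℕ-next-< i i<N)) (s≤s z≤n) , Step-prev step)))
  ρ-NonAdj (i , j) (k , l) (inj₂ (inj₂ (k<i , step))) with <last⊎≡last i | <last⊎≡last k
  ... | _       | inj₂ k≡N = ⊥-elim (NP.<⇒≱ k<i (subst (_ ≤_) (sym k≡N) (FP.toℕ≤pred[n] i)))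
  ... | inj₁ i<N | inj₁ k<N = subst₂ NonAdj (sym (ρ-<last i j i<N)) (sym (ρ-<last k l k<N))
    (inj₂ (inj₂ (subst₂ _<_ (sym (toℕ-next-< k k<N)) (sym (toℕ-next-< i i<N)) (s≤s k<i) , step)))
  ... | inj₂ i≡N | inj₁ k<N = subst₂ NonAdj (sym (ρ-last i j i≡N)) (sym (ρ-<last k l k<N))
    (inj₂ (inj₁ (subst (0 <_) (sym (toℕ-next-< k k<N)) (s≤s z≤n) , Step-prev step)))

  τ-NonAdj : ∀ x y → NonAdj x y → NonAdj (τ x) (τ y)
  τ-NonAdj _ _ (inj₁ (refl , refl))                  = inj₁ (refl , refl)
  τ-NonAdj (i , _) (k , _) (inj₂ (inj₁ (i<k , step))) = inj₂ (inj₂ (opposite-< i k i<k , Step-negate 1≤V step))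
  τ-NonAdj (i , _) (k , _) (inj₂ (inj₂ (k<i , step))) = inj₂ (inj₁ (opposite-< k i k<i , Step-negate 1≤V step))

  ρ⁻¹-NonAdj : ∀ x y → NonAdj x y → NonAdj (ρ⁻¹ x) (ρ⁻¹ y)
  ρ⁻¹-NonAdj x y nonAdj = subst₂ NonAdj (sym (ρ⁻¹≡τ∘ρ∘τ x)) (sym (ρ⁻¹≡τ∘ρ∘τ y))
                                 (τ-NonAdj _ _ (ρ-NonAdj _ _ (τ-NonAdj _ _ nonAdj)))

  rotation : Automorphism (suc N) (suc V)
  rotation = automorphism ρ ρ⁻¹ ρ∘ρ⁻¹ ρ⁻¹∘ρ ρ-NonAdj ρ⁻¹-NonAdj

  reflection : Automorphism (suc N) (suc V)
  reflection = automorphism τ τ τ-involutive τ-involutive τ-NonAdj τ-NonAdj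

-- Consecutive vertices of the ρ-cycle, characterised by adjacency alone

module Consecutiveness (N V : ℕ) (1≤N : 1 ≤ N) (2≤V : 2 ≤ V) where

  1≤V : 1 ≤ V
  1≤V = NP.<⇒≤ 2≤V

  open Symmetries N V 1≤V

  Private : Vtx → Vtx → Vtx → Set
  Private x y z = NonAdj x z × ¬ NonAdj y z

  Consecutive : Vtx → Vtx → Set
  Consecutive x y = x ≢ y × NonAdj x y × (∀ {z w} → Private x y z → Private x y w → z ≡ w)

  Consecutive-intro : ∀ {x y} u → x ≢ y → NonAdj x y → (∀ z → Private x y z → z ≡ u) → Consecutive x y
  Consecutive-intro u x≢y nonAdj only-u = x≢y , nonAdj , λ pz pw → trans (only-u _ pz) (sym (only-u _ pw))

  Consecutive⇒¬two-private : ∀ {x y z w} → Consecutive x y → Private x y z → Private x y w → z ≢ w → ⊥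
  Consecutive⇒¬two-private (_ , _ , unique) pz pw z≢w = z≢w (unique pz pw)

  Consecutive-preserved : (φ : Automorphism (suc N) (suc V)) →
                          ∀ x y → Consecutive x y → Consecutive (⟦ φ ⟧ x) (⟦ φ ⟧ y)
  Consecutive-preserved φ x y (x≢y , nonAdj , unique) =
    x≢y ∘ ⟦⟧-injective φ , NonAdj-preserved φ x y nonAdj , λ {z} {w} pz pw → begin
      z                    ≡⟨ ⟦⟧-inverseˡ φ z ⟨
      ⟦ φ ⟧ (⟦ φ ⟧⁻¹ z)    ≡⟨ cong ⟦ φ ⟧ (unique (pull-back pz) (pull-back pw)) ⟩
      ⟦ φ ⟧ (⟦ φ ⟧⁻¹ w)    ≡⟨ ⟦⟧-inverseˡ φ w ⟩
      w                    ∎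
    where
    open ≡-Reasoning
    pull-back : ∀ {z} → Private (⟦ φ ⟧ x) (⟦ φ ⟧ y) z → Private x y (⟦ φ ⟧⁻¹ z)
    pull-back {z} (nonAdj-xz , ¬nonAdj-yz) =
        NonAdj-reflected φ x _ (subst (NonAdj (⟦ φ ⟧ x)) (sym (⟦⟧-inverseˡ φ z)) nonAdj-xz)
      , ¬nonAdj-yz ∘ subst (NonAdj (⟦ φ ⟧ y)) (⟦⟧-inverseˡ φ z) ∘ NonAdj-preserved φ y _

  ¬NonAdj-intro : ∀ {i k : Fin (suc N)} {j l : Fin (suc V)} →
                  (i ≡ k → j ≢ l) → (toℕ i < toℕ k → ¬ Step j l) → (toℕ k < toℕ i → ¬ Step l j) →
                  ¬ NonAdj (i , j) (k , l)
  ¬NonAdj-intro ¬same _ _ (inj₁ (i≡k , j≡l))         = ¬same i≡k j≡l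
  ¬NonAdj-intro _ ¬later _ (inj₂ (inj₁ (i<k , step))) = ¬later i<k step
  ¬NonAdj-intro _ _ ¬earlier (inj₂ (inj₂ (k<i , step))) = ¬earlier k<i step

  ¬NonAdj-next-column : ∀ k j → ¬ NonAdj (k , next j) (k , j)
  ¬NonAdj-next-column k j = ¬NonAdj-intro (λ _ → next-irrefl 1≤V j) (λ k<k _ → NP.<-irrefl refl k<k)
                                          (λ k<k _ → NP.<-irrefl refl k<k)

  Consecutive-ρ : ∀ x → Consecutive x (ρ x)
  Consecutive-ρ (i , j) with <last⊎≡last i
  ... | inj₁ i<N = subst (Consecutive (i , j)) (sym (ρ-<last i j i<N))
                         (Consecutive-intro (next i , next j) x≢y x≁y only-u)
    where
    i+1 : toℕ (next i) ≡ suc (toℕ i)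
    i+1 = toℕ-next-< i i<N
    i<i+1 : toℕ i < toℕ (next i)
    i<i+1 = subst (toℕ i <_) (sym i+1) (NP.n<1+n _)
    x≢y : (i , j) ≢ (next i , j)
    x≢y eq = NP.<-irrefl (cong (toℕ ∘ proj₁) eq) i<i+1
    x≁y : NonAdj (i , j) (next i , j)
    x≁y = inj₂ (inj₁ (i<i+1 , inj₁ refl))
    only-u : ∀ z → Private (i , j) (next i , j) z → z ≡ (next i , next j)
    only-u _ (inj₁ (refl , refl) , ¬y≁z) = ⊥-elim (¬y≁z (inj₂ (inj₂ (i<i+1 , inj₁ refl))))
    only-u (a , b) (inj₂ (inj₁ (i<a , step)) , ¬y≁z) with toℕ a ℕ.≟ suc (toℕ i)
    ... | no a≢i+1 =
      ⊥-elim (¬y≁z (inj₂ (inj₁ (subst (_< toℕ a) (sym i+1) (NP.≤∧≢⇒< i<a (a≢i+1 ∘ sym)) , step))))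
    ... | yes a≡i+1 with step
    ...   | inj₁ b≡j      = ⊥-elim (¬y≁z (inj₁ (FP.toℕ-injective (trans i+1 (sym a≡i+1)) , sym b≡j)))
    ...   | inj₂ b≡next-j = vertex-≡ (trans a≡i+1 (sym i+1)) b≡next-j
    only-u (a , b) (inj₂ (inj₂ (a<i , step)) , ¬y≁z) =
      ⊥-elim (¬y≁z (inj₂ (inj₂ (NP.<-trans a<i i<i+1 , step))))
  ... | inj₂ i≡N = subst (Consecutive (i , j)) (sym (ρ-last i j i≡N))
                         (Consecutive-intro (zero , j) x≢y x≁y only-u)
    where
    0<i : 0 < toℕ i
    0<i = subst (0 <_) (sym i≡N) 1≤N
    x≢y : (i , j) ≢ (zero , prev j)
    x≢y eq = NP.<-irrefl (sym (cong (toℕ ∘ proj₁) eq)) 0<i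
    x≁y : NonAdj (i , j) (zero , prev j)
    x≁y = inj₂ (inj₂ (0<i , inj₂ (sym (next-prev j))))
    only-u : ∀ z → Private (i , j) (zero , prev j) z → z ≡ (zero , j)
    only-u _ (inj₁ (refl , refl) , ¬y≁z) = ⊥-elim (¬y≁z (inj₂ (inj₁ (0<i , inj₂ (sym (next-prev j))))))
    only-u (a , b) (inj₂ (inj₁ (i<a , _)) , _) =
      ⊥-elim (NP.<⇒≱ i<a (subst (toℕ a ≤_) (sym i≡N) (FP.toℕ≤pred[n] a)))
    only-u (zero  , b) (inj₂ (inj₂ (_ , inj₁ j≡b)) , _)      = cong (zero ,_) (sym j≡b)
    only-u (zero  , b) (inj₂ (inj₂ (_ , inj₂ j≡next-b)) , ¬y≁z) =
      ⊥-elim (¬y≁z (inj₁ (refl , trans (cong prev j≡next-b) (prev-next b))))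
    only-u (suc a , b) (inj₂ (inj₂ (_ , step)) , ¬y≁z) = ⊥-elim (¬y≁z (inj₂ (inj₁ (s≤s z≤n , Step-prev step))))

  Consecutive-later-same-column : ∀ i j k → toℕ i < toℕ k → Consecutive (i , j) (k , j) → (k , j) ≡ ρ (i , j)
  Consecutive-later-same-column i j k i<k consec with toℕ k ℕ.≟ suc (toℕ i)
  ... | yes k≡i+1 = trans (vertex-≡ (trans k≡i+1 (sym i+1)) refl) (sym (ρ-<last i j i<N))
    where
    i<N : toℕ i < N
    i<N = NP.<-≤-trans i<k (FP.toℕ≤pred[n] k)
    i+1 : toℕ (next i) ≡ suc (toℕ i)
    i+1 = toℕ-next-< i i<N
  ... | no k≢i+1 = ⊥-elim (Consecutive⇒¬two-private consec (z≁x , z∼y) (w≁x , w∼y) z≢w)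
    where
    i+1 : toℕ (next i) ≡ suc (toℕ i)
    i+1 = toℕ-next-< i (NP.<-≤-trans i<k (FP.toℕ≤pred[n] k))
    i+1<k : suc (toℕ i) < toℕ k
    i+1<k = NP.≤∧≢⇒< i<k (k≢i+1 ∘ sym)
    i+2 : toℕ (next (next i)) ≡ suc (suc (toℕ i))
    i+2 = trans (toℕ-next-< (next i) (subst (_< N) (sym i+1) (NP.<-≤-trans i+1<k (FP.toℕ≤pred[n] k))))
                (cong suc i+1)
    z w : Vtx
    z = next i , next j
    w = next (next i) , next j
    z≁x : NonAdj (i , j) z
    z≁x = inj₂ (inj₁ (subst (toℕ i <_) (sym i+1) (NP.n<1+n _) , inj₂ refl))
    w≁x : NonAdj (i , j) w
    w≁x = inj₂ (inj₁ (subst (toℕ i <_) (sym i+2) (NP.m<n⇒m<1+n (NP.n<1+n _)) , inj₂ refl))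
    z∼y : ¬ NonAdj (k , j) z
    z∼y = ¬NonAdj-intro (λ k≡i+1 _ → k≢i+1 (trans (cong toℕ k≡i+1) i+1))
                        (λ k<i+1 _ → NP.<-asym i+1<k (subst (toℕ k <_) i+1 k<i+1))
                        (λ _ → ¬Step-back 2≤V j)
    w∼y : ¬ NonAdj (k , j) w
    w∼y = ¬NonAdj-intro (λ _ → next-irrefl 1≤V j ∘ sym)
                        (λ k<i+2 _ → NP.<⇒≱ (subst (toℕ k <_) i+2 k<i+2) i+1<k)
                        (λ _ → ¬Step-back 2≤V j)
    z≢w : z ≢ w
    z≢w eq = NP.1+n≢n (sym (trans (sym i+1) (trans (cong (toℕ ∘ proj₁) eq) i+2)))

  Consecutive-later-next-column : ∀ i j k → toℕ i < toℕ k → Consecutive (i , j) (k , next j) →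
                                  (k , next j) ≡ ρ⁻¹ (i , j)
  Consecutive-later-next-column i j k i<k consec with <last⊎≡last k
  ... | inj₁ k<N = ⊥-elim (Consecutive⇒¬two-private consec (z≁x , z∼y) (w≁x , w∼y) z≢w)
    where
    k+1 : toℕ (next k) ≡ suc (toℕ k)
    k+1 = toℕ-next-< k k<N
    z w : Vtx
    z = k , j
    w = next k , j
    z≁x : NonAdj (i , j) z
    z≁x = inj₂ (inj₁ (i<k , inj₁ refl))
    w≁x : NonAdj (i , j) w
    w≁x = inj₂ (inj₁ (subst (toℕ i <_) (sym k+1) (NP.m<n⇒m<1+n i<k) , inj₁ refl))
    z∼y : ¬ NonAdj (k , next j) z
    z∼y = ¬NonAdj-next-column k j
    w∼y : ¬ NonAdj (k , next j) w
    w∼y = ¬NonAdj-intro (λ k≡k+1 _ → NP.1+n≢n (sym (trans (cong toℕ k≡k+1) k+1)))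
                        (λ _ → ¬Step-back 2≤V j)
                        (λ k+1<k _ → NP.<-asym (subst (_< toℕ k) k+1 k+1<k) (NP.n<1+n _))
    z≢w : z ≢ w
    z≢w eq = NP.1+n≢n (sym (trans (cong (toℕ ∘ proj₁) eq) k+1))
  Consecutive-later-next-column zero    j k i<k consec | inj₂ k≡N =
    vertex-≡ (trans k≡N (sym toℕ-prev-zero)) refl
  Consecutive-later-next-column (suc i) j k i<k consec | inj₂ k≡N =
    ⊥-elim (Consecutive⇒¬two-private consec (z≁x , z∼y) (w≁x , w∼y) z≢w)
    where
    z w : Vtx
    z = k , j
    w = zero , prev j
    z≁x : NonAdj (suc i , j) z
    z≁x = inj₂ (inj₁ (i<k , inj₁ refl))
    w≁x : NonAdj (suc i , j) w
    w≁x = inj₂ (inj₂ (s≤s z≤n , inj₂ (sym (next-prev j))))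
    z∼y : ¬ NonAdj (k , next j) z
    z∼y = ¬NonAdj-next-column k j
    w∼y : ¬ NonAdj (k , next j) w
    w∼y = ¬NonAdj-intro (λ k≡0 _ → NP.n>0⇒n≢0 1≤N (trans (sym k≡N) (cong toℕ k≡0)))
                        (λ ())
                        (λ _ → ¬Step-prev-next 2≤V j)
    z≢w : z ≢ w
    z≢w eq = NP.n>0⇒n≢0 1≤N (trans (sym k≡N) (cong (toℕ ∘ proj₁) eq))

  Consecutive-later : ∀ i j k l → toℕ i < toℕ k → Step j l → Consecutive (i , j) (k , l) →
                      (k , l) ≡ ρ (i , j) ⊎ (k , l) ≡ ρ⁻¹ (i , j)
  Consecutive-later i j k _ i<k (inj₁ refl) consec = inj₁ (Consecutive-later-same-column i j k i<k consec)
  Consecutive-later i j k _ i<k (inj₂ refl) consec = inj₂ (Consecutive-later-next-column i j k i<k consec)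

  Consecutive⇒ρ⊎ρ⁻¹ : ∀ x y → Consecutive x y → y ≡ ρ x ⊎ y ≡ ρ⁻¹ x
  Consecutive⇒ρ⊎ρ⁻¹ x y consec@(x≢y , x≁y , _) with x≁y
  ... | inj₁ (refl , refl)        = ⊥-elim (x≢y refl)
  ... | inj₂ (inj₁ (i<k , step)) = Consecutive-later _ _ _ _ i<k step consec
  -- y lies in an earlier row: τ reverses the rows and conjugates ρ into ρ⁻¹.
  ... | inj₂ (inj₂ (k<i , step)) with Consecutive-later _ _ _ _ (opposite-< _ _ k<i) (Step-negate 1≤V step)
                                        (Consecutive-preserved reflection x y consec)
  ...   | inj₁ τy≡ρτx  = inj₂ (trans (sym (τ-involutive y)) (trans (cong τ τy≡ρτx) (sym (ρ⁻¹≡τ∘ρ∘τ x))))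
  ...   | inj₂ τy≡ρ⁻¹τx = inj₁ (trans (sym (τ-involutive y)) (trans (cong τ τy≡ρ⁻¹τx) (sym (ρ≡τ∘ρ⁻¹∘τ x))))

-- Labelling the vertices along the ρ-cycle

module Labelling (N V : ℕ) (1≤V : 1 ≤ V) where

  open Symmetries N V 1≤V

  n m : ℕ
  n = suc N
  m = n * suc V

  p₀ : Vtx
  p₀ = zero , fromℕ V

  label : Vtx → ℕ
  label (i , j) = toℕ i + n * (V ∸ toℕ j)

  ρ-iterate-in-column : ∀ t (t<n : t < n) j → fold (zero , j) ρ t ≡ (fromℕ< t<n , j)
  ρ-iterate-in-column zero    t<n j = refl
  ρ-iterate-in-column (suc t) t+1<n j = begin
    ρ (fold (zero , j) ρ t)  ≡⟨ cong ρ (ρ-iterate-in-column t t<n j) ⟩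
    ρ (fromℕ< t<n , j)       ≡⟨ ρ-<last _ j t<N ⟩
    (next (fromℕ< t<n) , j)  ≡⟨ vertex-≡ (trans (toℕ-next-< _ t<N) (trans (cong suc (FP.toℕ-fromℕ< t<n))
                                                                  (sym (FP.toℕ-fromℕ< t+1<n)))) refl ⟩
    (fromℕ< t+1<n , j)       ∎
    where
    open ≡-Reasoning
    t<n : t < n
    t<n = NP.<-trans (NP.n<1+n t) t+1<n
    t<N : toℕ (fromℕ< t<n) < N
    t<N = subst (_< N) (sym (FP.toℕ-fromℕ< t<n)) (NP.≤-pred t+1<n)

  ρ-iterate-to-row : ∀ i j → fold (zero , j) ρ (toℕ i) ≡ (i , j)
  ρ-iterate-to-row i j = trans (ρ-iterate-in-column (toℕ i) (FP.toℕ<n i) j)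
                               (cong (_, j) (FP.fromℕ<-toℕ i (FP.toℕ<n i)))

  ρ-iterate-n : ∀ j → fold (zero , j) ρ n ≡ (zero , prev j)
  ρ-iterate-n j = trans (cong ρ (ρ-iterate-in-column N (NP.n<1+n N) j))
                        (ρ-last _ j (FP.toℕ-fromℕ< (NP.n<1+n N)))

  ρ-iterate-n* : ∀ c j → fold (zero , j) ρ (n * c) ≡ (zero , fold j prev c)
  ρ-iterate-n* zero    j = cong (fold (zero , j) ρ) (NP.*-zeroʳ n)
  ρ-iterate-n* (suc c) j = begin
    fold (zero , j) ρ (n * suc c)                ≡⟨ cong (fold (zero , j) ρ) (NP.*-suc n c) ⟩
    fold (zero , j) ρ (n + n * c)                ≡⟨ fold-+ (zero , j) ρ n ⟩
    fold (fold (zero , j) ρ (n * c)) ρ n         ≡⟨ cong (λ x → fold x ρ n) (ρ-iterate-n* c j) ⟩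
    fold (zero , fold j prev c) ρ n              ≡⟨ ρ-iterate-n _ ⟩
    (zero , prev (fold j prev c))                ∎
    where open ≡-Reasoning

  toℕ-prev-iterate : ∀ c → c ≤ V → toℕ (fold (fromℕ V) prev c) ≡ V ∸ c
  toℕ-prev-iterate zero    _     = FP.toℕ-fromℕ V
  toℕ-prev-iterate (suc c) c+1≤V =
    toℕ-prev-suc _ (trans (toℕ-prev-iterate c (NP.≤-trans (NP.n≤1+n c) c+1≤V)) (NP.+-∸-assoc 1 c+1≤V))

  ρ-iterate-label : ∀ x → fold p₀ ρ (label x) ≡ x
  ρ-iterate-label (i , j) = begin
    fold p₀ ρ (toℕ i + n * (V ∸ toℕ j))                     ≡⟨ fold-+ p₀ ρ (toℕ i) ⟩
    fold (fold p₀ ρ (n * (V ∸ toℕ j))) ρ (toℕ i)            ≡⟨ cong (λ x → fold x ρ (toℕ i))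
                                                                    (ρ-iterate-n* (V ∸ toℕ j) (fromℕ V)) ⟩
    fold (zero , fold (fromℕ V) prev (V ∸ toℕ j)) ρ (toℕ i) ≡⟨ ρ-iterate-to-row i _ ⟩
    (i , fold (fromℕ V) prev (V ∸ toℕ j))                   ≡⟨ vertex-≡ refl (FP.toℕ-injective column) ⟩
    (i , j)                                                 ∎
    where
    open ≡-Reasoning
    column : toℕ (fold (fromℕ V) prev (V ∸ toℕ j)) ≡ toℕ j
    column = trans (toℕ-prev-iterate (V ∸ toℕ j) (NP.m∸n≤m V (toℕ j))) (NP.m∸[m∸n]≡n (FP.toℕ≤pred[n] j))

  label-p₀ : label p₀ ≡ 0
  label-p₀ = trans (cong (λ u → n * (V ∸ u)) (FP.toℕ-fromℕ V)) (trans (cong (n *_) (NP.n∸n≡0 V)) (NP.*-zeroʳ n))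

  ρ-iterate-m : ∀ x → fold x ρ m ≡ x
  ρ-iterate-m x = begin
    fold x ρ m                            ≡⟨ cong (λ y → fold y ρ m) (ρ-iterate-label x) ⟨
    fold (fold p₀ ρ (label x)) ρ m        ≡⟨ fold-+ p₀ ρ m ⟨
    fold p₀ ρ (m + label x)               ≡⟨ cong (fold p₀ ρ) (NP.+-comm m (label x)) ⟩
    fold p₀ ρ (label x + m)               ≡⟨ fold-+ p₀ ρ (label x) ⟩
    fold (fold p₀ ρ m) ρ (label x)        ≡⟨ cong (λ y → fold y ρ (label x)) ρ-iterate-m-p₀ ⟩
    fold p₀ ρ (label x)                   ≡⟨ ρ-iterate-label x ⟩
    x                                     ∎
    where
    open ≡-Reasoning
    ρ-iterate-m-p₀ : fold p₀ ρ m ≡ p₀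
    ρ-iterate-m-p₀ = trans (ρ-iterate-n* (suc V) (fromℕ V))
      (cong (λ u → zero , prev u) (FP.toℕ-injective {j = zero} (trans (toℕ-prev-iterate V NP.≤-refl) (NP.n∸n≡0 V))))

  ρ-iterate-*m : ∀ q x → fold x ρ (q * m) ≡ x
  ρ-iterate-*m zero    x = refl
  ρ-iterate-*m (suc q) x =
    trans (fold-+ x ρ m) (trans (cong (λ y → fold y ρ m) (ρ-iterate-*m q x)) (ρ-iterate-m x))

  ρ-iterate-∸≡*m : ∀ x q {c d} → c ≤ d → d ∸ c ≡ q * m → fold x ρ d ≡ fold x ρ c
  ρ-iterate-∸≡*m x q {c} {d} c≤d d-c≡qm = begin
    fold x ρ d                  ≡⟨ cong (fold x ρ) (NP.m∸n+n≡m c≤d) ⟨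
    fold x ρ (d ∸ c + c)        ≡⟨ cong (λ k → fold x ρ (k + c)) d-c≡qm ⟩
    fold x ρ (q * m + c)        ≡⟨ fold-+ x ρ (q * m) ⟩
    fold (fold x ρ c) ρ (q * m) ≡⟨ ρ-iterate-*m q _ ⟩
    fold x ρ c                  ∎
    where open ≡-Reasoning

  ρ-iterate-∣-∣ : ∀ x q {a b} → ℕ.∣ a - b ∣ ≡ q * m → fold x ρ a ≡ fold x ρ b
  ρ-iterate-∣-∣ x q {a} {b} ∣a-b∣≡qm with NP.≤-total a b
  ... | inj₁ a≤b = sym (ρ-iterate-∸≡*m x q a≤b (trans (sym (NP.m≤n⇒∣m-n∣≡n∸m a≤b)) ∣a-b∣≡qm))
  ... | inj₂ b≤a = ρ-iterate-∸≡*m x q b≤a (trans (sym (NP.m≤n⇒∣n-m∣≡n∸m b≤a)) ∣a-b∣≡qm)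

  label-ρ : ∀ x → label (ρ x) ≡ suc (label x) ⊎ (label (ρ x) ≡ 0 × suc (label x) ≡ m)
  label-ρ (i , j) with <last⊎≡last i
  ... | inj₁ i<N = inj₁ (trans (cong label (ρ-<last i j i<N)) (cong (_+ n * (V ∸ toℕ j)) (toℕ-next-< i i<N)))
  label-ρ (i , zero) | inj₂ i≡N = inj₂ (wraps-to-0 , m≡)
    where
    wraps-to-0 : label (ρ (i , zero)) ≡ 0
    wraps-to-0 = trans (cong label (ρ-last i zero i≡N))
      (trans (cong (λ u → n * (V ∸ u)) (toℕ-prev-zero {V})) (trans (cong (n *_) (NP.n∸n≡0 V)) (NP.*-zeroʳ n)))
    m≡ : suc (toℕ i + n * V) ≡ m
    m≡ = trans (cong (λ u → suc u + n * V) i≡N) (sym (NP.*-suc n V))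
  label-ρ (i , suc j) | inj₂ i≡N = inj₁ (trans (cong label (ρ-last i (suc j) i≡N)) (begin
    n * (V ∸ toℕ (prev (suc j)))       ≡⟨ cong (λ u → n * (V ∸ u)) (FP.toℕ-inject₁ j) ⟩
    n * (V ∸ toℕ j)                    ≡⟨ cong (n *_) (NP.+-∸-assoc 1 (FP.toℕ≤pred[n] (suc j))) ⟩
    n * suc (V ∸ suc (toℕ j))          ≡⟨ NP.*-suc n _ ⟩
    suc N + n * (V ∸ suc (toℕ j))      ≡⟨ cong (λ u → suc u + n * (V ∸ suc (toℕ j))) i≡N ⟨
    suc (toℕ i + n * (V ∸ suc (toℕ j))) ∎))
    where open ≡-Reasoning

negateIf : Bool → ℤ → ℤ
negateIf false z = z
negateIf true  z = ℤ.- z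

negateIf-0 : ∀ e → negateIf e (+ 0) ≡ + 0
negateIf-0 false = refl
negateIf-0 true  = refl

negateIf-+ : ∀ e a b → negateIf e (a ℤ.+ b) ≡ negateIf e a ℤ.+ negateIf e b
negateIf-+ false a b = refl
negateIf-+ true  a b = ZP.neg-distrib-+ a b

negateIf-xor : ∀ e d x → negateIf e (negateIf d x) ≡ negateIf (e xor d) x
negateIf-xor false d     x = refl
negateIf-xor true  false x = refl
negateIf-xor true  true  x = ZP.neg-involutive x

module Congruence (m : ℕ) where
  open +-*-Solver using (solve; _:+_; _:-_; :-_; _:=_; con)

  infix 4 _≡ₘ_
  -- A record rather than _≡[_]_, so that both sides can be inferred.
  record _≡ₘ_ (a b : ℤ) : Set where
    constructor mod
    field m∣a-b : (+ m) ZS.∣ (a ℤ.- b)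

  ≡⇒≡ₘ : ∀ {a b} → a ≡ b → a ≡ₘ b
  ≡⇒≡ₘ {a} refl = mod (subst ((+ m) ZS.∣_) (sym (ZP.+-inverseʳ a)) (ZS.divides (+ 0) refl))

  ≡ₘ-refl : ∀ {a} → a ≡ₘ a
  ≡ₘ-refl = ≡⇒≡ₘ refl

  ≡ₘ-sym : ∀ {a b} → a ≡ₘ b → b ≡ₘ a
  ≡ₘ-sym {a} {b} (mod m∣a-b) =
    mod (subst ((+ m) ZS.∣_) (solve 2 (λ a b → :- (a :- b) := b :- a) refl a b) (ZS.∣m⇒∣-m m∣a-b))

  ≡ₘ-trans : ∀ {a b c} → a ≡ₘ b → b ≡ₘ c → a ≡ₘ c
  ≡ₘ-trans {a} {b} {c} (mod m∣a-b) (mod m∣b-c) =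
    mod (subst ((+ m) ZS.∣_) (solve 3 (λ a b c → (a :- b) :+ (b :- c) := a :- c) refl a b c)
               (ZS.∣m∣n⇒∣m+n m∣a-b m∣b-c))

  +-cong : ∀ {a b c d} → a ≡ₘ b → c ≡ₘ d → a ℤ.+ c ≡ₘ b ℤ.+ d
  +-cong {a} {b} {c} {d} (mod m∣a-b) (mod m∣c-d) =
    mod (subst ((+ m) ZS.∣_) (solve 4 (λ a b c d → (a :- b) :+ (c :- d) := (a :+ c) :- (b :+ d)) refl a b c d)
               (ZS.∣m∣n⇒∣m+n m∣a-b m∣c-d))

  +-congˡ : ∀ a {c d} → c ≡ₘ d → a ℤ.+ c ≡ₘ a ℤ.+ d
  +-congˡ a = +-cong (≡ₘ-refl {a})

  +-cancelˡ : ∀ a {c d} → a ℤ.+ c ≡ₘ a ℤ.+ d → c ≡ₘ d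
  +-cancelˡ a {c} {d} a+c≡a+d = subst₂ _≡ₘ_ (−a+[a+x]≡x c) (−a+[a+x]≡x d) (+-congˡ (ℤ.- a) a+c≡a+d)
    where
    −a+[a+x]≡x : ∀ x → ℤ.- a ℤ.+ (a ℤ.+ x) ≡ x
    −a+[a+x]≡x = solve 2 (λ a x → (:- a) :+ (a :+ x) := x) refl a

  -‿cong : ∀ {a b} → a ≡ₘ b → ℤ.- a ≡ₘ ℤ.- b
  -‿cong {a} {b} (mod m∣a-b) =
    mod (subst ((+ m) ZS.∣_) (solve 2 (λ a b → :- (a :- b) := (:- a) :- (:- b)) refl a b) (ZS.∣m⇒∣-m m∣a-b))

  m≡ₘ0 : + m ≡ₘ + 0
  m≡ₘ0 = mod (subst ((+ m) ZS.∣_) (sym (ZP.+-identityʳ (+ m))) ZS.∣-refl)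

  ≡ₘ-setoid : Setoid 0ℓ 0ℓ
  ≡ₘ-setoid = record
    { Carrier = ℤ ; _≈_ = _≡ₘ_
    ; isEquivalence = record { refl = ≡ₘ-refl ; sym = ≡ₘ-sym ; trans = ≡ₘ-trans } }

  ≡ₘ⇒≡[] : ∀ {a b} → a ≡ₘ b → a ≡[ m ] b
  ≡ₘ⇒≡[] (mod m∣a-b) = ZS.∣⇒∣ᵤ m∣a-b

  ≡[]⇒≡ₘ : ∀ {a b} → a ≡[ m ] b → a ≡ₘ b
  ≡[]⇒≡ₘ m∣a-b = mod (ZS.∣ᵤ⇒∣ m∣a-b)

  %ℕ-≡ₘ : .{{_ : NonZero m}} → ∀ z → + (z %ℕ m) ≡ₘ z
  %ℕ-≡ₘ z = mod (subst (λ u → (+ m) ZS.∣ (+ r ℤ.- u)) (sym (a≡a%ℕn+[a/ℕn]*n z m))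
                      (subst ((+ m) ZS.∣_) −qm≡r-[r+qm] (ZS.∣m⇒∣-m (ZS.∣n⇒∣m*n (z /ℕ m) ZS.∣-refl))))
    where
    r : ℕ
    r = z %ℕ m
    −qm≡r-[r+qm] : ℤ.- ((z /ℕ m) ℤ.* + m) ≡ + r ℤ.- (+ r ℤ.+ (z /ℕ m) ℤ.* + m)
    −qm≡r-[r+qm] = solve 2 (λ r q → :- q := r :- (r :+ q)) refl (+ r) ((z /ℕ m) ℤ.* + m)

  negateIf-cong : ∀ e {a b} → a ≡ₘ b → negateIf e a ≡ₘ negateIf e b
  negateIf-cong false a≡b = a≡b
  negateIf-cong true  a≡b = -‿cong a≡b

  negateIf-1-injective : 3 ≤ m → ∀ e d → negateIf e (+ 1) ≡ₘ negateIf d (+ 1) → e ≡ d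
  negateIf-1-injective _   false false _ = refl
  negateIf-1-injective _   true  true  _ = refl
  negateIf-1-injective 3≤m false true  (mod m∣2) = ⊥-elim (NP.<⇒≱ 3≤m (ND.∣⇒≤ (ZS.∣⇒∣ᵤ m∣2)))
  negateIf-1-injective 3≤m true  false (mod m∣2) = ⊥-elim (NP.<⇒≱ 3≤m (ND.∣⇒≤ (ZS.∣⇒∣ᵤ m∣2)))


-- Every automorphism commutes with ρ up to orientation

module Rigidity (N V : ℕ) (1≤N : 1 ≤ N) (2≤V : 2 ≤ V) where

  open Consecutiveness N V 1≤N 2≤V
  open Symmetries N V 1≤V
  open Labelling N V 1≤V
  open Congruence m

  Aut : Set
  Aut = Automorphism (suc N) (suc V)

  3≤m : 3 ≤ m
  3≤m = NP.≤-trans (s≤s 2≤V) (NP.m≤m+n (suc V) (N * suc V))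

  ρ± : Bool → Vtx → Vtx
  ρ± false = ρ
  ρ± true  = ρ⁻¹

  ρ±-cancel : ∀ e x → ρ± (not e) (ρ± e x) ≡ x
  ρ±-cancel false = ρ⁻¹∘ρ
  ρ±-cancel true  = ρ∘ρ⁻¹

  ℓ : Vtx → ℤ
  ℓ x = + label x

  ℓ-ρ : ∀ x → ℓ (ρ x) ≡ₘ ℓ x ℤ.+ + 1
  ℓ-ρ x with label-ρ x
  ... | inj₁ eq           = ≡⇒≡ₘ (cong +_ (trans eq (NP.+-comm 1 (label x))))
  ... | inj₂ (wraps , m≡) = subst₂ _≡ₘ_ (cong +_ (sym wraps)) (cong +_ (trans (sym m≡) (NP.+-comm 1 (label x))))
                                  (≡ₘ-sym m≡ₘ0)

  ℓ-ρ± : ∀ e x → ℓ (ρ± e x) ≡ₘ ℓ x ℤ.+ negateIf e (+ 1)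
  ℓ-ρ± false x = ℓ-ρ x
  ℓ-ρ± true  x = begin
    ℓ (ρ⁻¹ x)                        ≡⟨ solve 1 (λ y → y := (y :+ con (+ 1)) :- con (+ 1)) refl (ℓ (ρ⁻¹ x)) ⟩
    ℓ (ρ⁻¹ x) ℤ.+ + 1 ℤ.- + 1        ≈⟨ +-cong (ℓ-ρ (ρ⁻¹ x)) (≡ₘ-refl {ℤ.- + 1}) ⟨
    ℓ (ρ (ρ⁻¹ x)) ℤ.- + 1            ≡⟨ cong (λ y → ℓ y ℤ.- + 1) (ρ∘ρ⁻¹ x) ⟩
    ℓ x ℤ.- + 1                      ∎
    where
    open +-*-Solver using (solve; _:+_; _:-_; _:=_; con)
    open SetoidReasoning ≡ₘ-setoid

  ℓ-ρ±-iterate : ∀ e t x → ℓ (fold x (ρ± e) t) ≡ₘ ℓ x ℤ.+ negateIf e (+ t)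
  ℓ-ρ±-iterate e zero    x = ≡⇒≡ₘ (sym (trans (cong (λ z → ℓ x ℤ.+ z) (negateIf-0 e)) (ZP.+-identityʳ (ℓ x))))
  ℓ-ρ±-iterate e (suc t) x = begin
    ℓ (ρ± e (fold x (ρ± e) t))                       ≈⟨ ℓ-ρ± e _ ⟩
    ℓ (fold x (ρ± e) t) ℤ.+ negateIf e (+ 1)         ≈⟨ +-cong (ℓ-ρ±-iterate e t x) ≡ₘ-refl ⟩
    ℓ x ℤ.+ negateIf e (+ t) ℤ.+ negateIf e (+ 1)    ≡⟨ solve 3 (λ a b c → (a :+ b) :+ c := a :+ (c :+ b)) refl
                                                             (ℓ x) (negateIf e (+ t)) (negateIf e (+ 1)) ⟩
    ℓ x ℤ.+ (negateIf e (+ 1) ℤ.+ negateIf e (+ t))  ≡⟨ cong (λ z → ℓ x ℤ.+ z) (negateIf-+ e (+ 1) (+ t)) ⟨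
    ℓ x ℤ.+ negateIf e (+ suc t)                     ∎
    where
    open +-*-Solver using (solve; _:+_; _:=_)
    open SetoidReasoning ≡ₘ-setoid

  ℓ-injective : ∀ {x y} → ℓ x ≡ₘ ℓ y → x ≡ y
  ℓ-injective {x} {y} x≡y with ≡ₘ⇒≡[] x≡y
  ... | ND.divides q ∣ℓx-ℓy∣≡qm = begin
    x                    ≡⟨ ρ-iterate-label x ⟨
    fold p₀ ρ (label x)  ≡⟨ ρ-iterate-∣-∣ p₀ q {label x} {label y} ∣x-y∣≡qm ⟩
    fold p₀ ρ (label y)  ≡⟨ ρ-iterate-label y ⟩
    y                    ∎
    where
    open ≡-Reasoning
    ∣x-y∣≡qm : ℕ.∣ label x - label y ∣ ≡ q * m
    ∣x-y∣≡qm = trans (sym (∣+m-+n∣≡∣m-n∣ (label x) (label y))) ∣ℓx-ℓy∣≡qm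

  ρ∘ρ-irrefl : ∀ x → ρ (ρ x) ≢ x
  ρ∘ρ-irrefl x ρρx≡x = false≢true (negateIf-1-injective 3≤m false true (+-cancelˡ (ℓ x) (begin
    ℓ x ℤ.+ + 1              ≈⟨ ℓ-ρ x ⟨
    ℓ (ρ x)                  ≡⟨ cong ℓ (trans (sym (ρ⁻¹∘ρ (ρ x))) (cong ρ⁻¹ ρρx≡x)) ⟩
    ℓ (ρ⁻¹ x)                ≈⟨ ℓ-ρ± true x ⟩
    ℓ x ℤ.+ ℤ.- + 1          ∎)))
    where
    open SetoidReasoning ≡ₘ-setoid
    false≢true : false ≢ true
    false≢true ()

  ⟦⟧-ρ : ∀ φ y → Σ Bool λ e → ⟦ φ ⟧ (ρ y) ≡ ρ± e (⟦ φ ⟧ y)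
  ⟦⟧-ρ φ y with Consecutive⇒ρ⊎ρ⁻¹ _ _ (Consecutive-preserved φ y (ρ y) (Consecutive-ρ y))
  ... | inj₁ eq = false , eq
  ... | inj₂ eq = true , eq

  orientation-propagates : ∀ φ e y → ⟦ φ ⟧ (ρ y) ≡ ρ± e (⟦ φ ⟧ y) →
                           ⟦ φ ⟧ (ρ (ρ y)) ≡ ρ± e (⟦ φ ⟧ (ρ y))
  orientation-propagates φ e y eq with ⟦⟧-ρ φ (ρ y)
  ... | e′ , eq′ with e′ ≟ e
  ...   | yes refl = eq′
  ...   | no e′≢e  = ⊥-elim (ρ∘ρ-irrefl y (⟦⟧-injective φ (begin
    ⟦ φ ⟧ (ρ (ρ y))              ≡⟨ eq′ ⟩
    ρ± e′ (⟦ φ ⟧ (ρ y))          ≡⟨ cong₂ ρ± (BP.¬-not e′≢e) eq ⟩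
    ρ± (not e) (ρ± e (⟦ φ ⟧ y))  ≡⟨ ρ±-cancel e (⟦ φ ⟧ y) ⟩
    ⟦ φ ⟧ y                      ∎)))
    where open ≡-Reasoning

  ⟦⟧-ρ-iterate : ∀ φ e x → ⟦ φ ⟧ (ρ x) ≡ ρ± e (⟦ φ ⟧ x) →
                 ∀ t → ⟦ φ ⟧ (fold x ρ t) ≡ fold (⟦ φ ⟧ x) (ρ± e) t
  ⟦⟧-ρ-iterate φ e x eq = iterate
    where
    one-step : ∀ t → ⟦ φ ⟧ (ρ (fold x ρ t)) ≡ ρ± e (⟦ φ ⟧ (fold x ρ t))
    one-step zero    = eq
    one-step (suc t) = orientation-propagates φ e _ (one-step t)
    iterate : ∀ t → ⟦ φ ⟧ (fold x ρ t) ≡ fold (⟦ φ ⟧ x) (ρ± e) t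
    iterate zero    = refl
    iterate (suc t) = trans (one-step t) (cong (ρ± e) (iterate t))

  _≟ᵥ_ : (x y : Vtx) → Dec (x ≡ y)
  _≟ᵥ_ = ≡-dec FP._≟_ FP._≟_

  orientation : Aut → Bool
  orientation φ = does (⟦ φ ⟧ (ρ p₀) ≟ᵥ ρ⁻¹ (⟦ φ ⟧ p₀))

  ⟦⟧-ρ-orientation : ∀ φ → ⟦ φ ⟧ (ρ p₀) ≡ ρ± (orientation φ) (⟦ φ ⟧ p₀)
  ⟦⟧-ρ-orientation φ with ⟦ φ ⟧ (ρ p₀) ≟ᵥ ρ⁻¹ (⟦ φ ⟧ p₀) | ⟦⟧-ρ φ p₀
  ... | yes eq | _          = eq
  ... | no _   | false , eq = eq
  ... | no ¬eq | true  , eq = ⊥-elim (¬eq eq)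

  record Affine (φ : Aut) (a : ℤ) (e : Bool) : Set where
    constructor affine
    field ℓ-⟦⟧ : ∀ x → ℓ (⟦ φ ⟧ x) ≡ₘ a ℤ.+ negateIf e (ℓ x)
  open Affine public

  automorphism-affine : ∀ φ → Affine φ (ℓ (⟦ φ ⟧ p₀)) (orientation φ)
  automorphism-affine φ = affine λ x → begin
    ℓ (⟦ φ ⟧ x)                           ≡⟨ cong (ℓ ∘ ⟦ φ ⟧) (ρ-iterate-label x) ⟨
    ℓ (⟦ φ ⟧ (fold p₀ ρ (label x)))       ≡⟨ cong ℓ (⟦⟧-ρ-iterate φ e p₀ (⟦⟧-ρ-orientation φ) (label x)) ⟩
    ℓ (fold (⟦ φ ⟧ p₀) (ρ± e) (label x))  ≈⟨ ℓ-ρ±-iterate e (label x) (⟦ φ ⟧ p₀) ⟩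
    ℓ (⟦ φ ⟧ p₀) ℤ.+ negateIf e (ℓ x)     ∎
    where
    open SetoidReasoning ≡ₘ-setoid
    e : Bool
    e = orientation φ

module DihedralIsomorphism (N V : ℕ) (1≤N : 1 ≤ N) (2≤V : 2 ≤ V) where

  open Consecutiveness N V 1≤N 2≤V using (1≤V)
  open Symmetries N V 1≤V
  open Labelling N V 1≤V
  open Congruence m
  open Rigidity N V 1≤N 2≤V

  G D : RawGroup 0ℓ 0ℓ
  G = AutGroup (suc N) (suc V)
  D = Dihedral m
  module G = RawGroup G
  module D = RawGroup D

  ℓ-p₀ : ℓ p₀ ≡ + 0
  ℓ-p₀ = cong +_ label-p₀

  ℓ-ρ-p₀ : ℓ (ρ p₀) ≡ₘ + 1
  ℓ-ρ-p₀ = ≡ₘ-trans (ℓ-ρ p₀) (≡⇒≡ₘ (cong (ℤ._+ + 1) ℓ-p₀))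

  Affine-p₀ : ∀ {φ a e} → Affine φ a e → ℓ (⟦ φ ⟧ p₀) ≡ₘ a
  Affine-p₀ {φ} {a} {e} aff = ≡ₘ-trans (ℓ-⟦⟧ aff p₀) (≡⇒≡ₘ (begin
    a ℤ.+ negateIf e (ℓ p₀)  ≡⟨ cong (λ u → a ℤ.+ negateIf e u) ℓ-p₀ ⟩
    a ℤ.+ negateIf e (+ 0)   ≡⟨ cong (λ u → a ℤ.+ u) (negateIf-0 e) ⟩
    a ℤ.+ + 0                ≡⟨ ZP.+-identityʳ a ⟩
    a                        ∎))
    where open ≡-Reasoning

  Affine-orientation : ∀ {φ a e} → Affine φ a e → e ≡ orientation φ
  Affine-orientation {φ} {a} {e} aff = negateIf-1-injective 3≤m e o (+-cancelˡ a (begin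
    a ℤ.+ negateIf e (+ 1)             ≈⟨ +-congˡ a (negateIf-cong e ℓ-ρ-p₀) ⟨
    a ℤ.+ negateIf e (ℓ (ρ p₀))        ≈⟨ ℓ-⟦⟧ aff (ρ p₀) ⟨
    ℓ (⟦ φ ⟧ (ρ p₀))                   ≈⟨ ℓ-⟦⟧ (automorphism-affine φ) (ρ p₀) ⟩
    ℓ (⟦ φ ⟧ p₀) ℤ.+ negateIf o (ℓ (ρ p₀)) ≈⟨ +-cong (Affine-p₀ aff) (negateIf-cong o ℓ-ρ-p₀) ⟩
    a ℤ.+ negateIf o (+ 1)             ∎))
    where
    open SetoidReasoning ≡ₘ-setoid
    o : Bool
    o = orientation φ

  Affine-unique : ∀ {φ ψ a e} → Affine φ a e → Affine ψ a e → φ G.≈ ψ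
  Affine-unique affφ affψ x = ℓ-injective (≡ₘ-trans (ℓ-⟦⟧ affφ x) (≡ₘ-sym (ℓ-⟦⟧ affψ x)))

  Affine-cong : ∀ {φ a a′ e} → a ≡ₘ a′ → Affine φ a e → Affine φ a′ e
  Affine-cong a≡a′ aff = affine λ x → ≡ₘ-trans (ℓ-⟦⟧ aff x) (+-cong a≡a′ ≡ₘ-refl)

  Affine-≈ : ∀ {φ a e} ψ → ψ G.≈ φ → Affine φ a e → Affine ψ a e
  Affine-≈ ψ ψ≈φ aff = affine λ x → subst (λ y → ℓ y ≡ₘ _) (sym (ψ≈φ x)) (ℓ-⟦⟧ aff x)

  Affine-ε : Affine G.ε (+ 0) false
  Affine-ε = affine λ x → ≡⇒≡ₘ (sym (ZP.+-identityˡ (ℓ x)))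

  Affine-∙ : ∀ {φ ψ a b c d} → Affine φ a b → Affine ψ c d →
             Affine (φ G.∙ ψ) (a ℤ.+ negateIf b c) (b xor d)
  Affine-∙ {φ} {ψ} {a} {b} {c} {d} affφ affψ = affine λ x → begin
    ℓ (⟦ φ ⟧ (⟦ ψ ⟧ x))                                    ≈⟨ ℓ-⟦⟧ affφ (⟦ ψ ⟧ x) ⟩
    a ℤ.+ negateIf b (ℓ (⟦ ψ ⟧ x))                         ≈⟨ +-congˡ a (negateIf-cong b (ℓ-⟦⟧ affψ x)) ⟩
    a ℤ.+ negateIf b (c ℤ.+ negateIf d (ℓ x))              ≡⟨ cong (λ u → a ℤ.+ u) (negateIf-+ b c _) ⟩
    a ℤ.+ (negateIf b c ℤ.+ negateIf b (negateIf d (ℓ x))) ≡⟨ cong (λ u → a ℤ.+ (negateIf b c ℤ.+ u))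
                                                                    (negateIf-xor b d (ℓ x)) ⟩
    a ℤ.+ (negateIf b c ℤ.+ negateIf (b xor d) (ℓ x))      ≡⟨ ZP.+-assoc a _ _ ⟨
    a ℤ.+ negateIf b c ℤ.+ negateIf (b xor d) (ℓ x)        ∎
    where open SetoidReasoning ≡ₘ-setoid

  Affine-⁻¹ : ∀ {φ a e} → Affine φ a e → Affine (φ G.⁻¹) (negateIf (not e) a) e
  Affine-⁻¹ {φ} {a} {false} aff = affine λ x → begin
    ℓ (⟦ φ ⟧⁻¹ x)                      ≡⟨ solve 2 (λ a y → y := (:- a) :+ (a :+ y)) refl a (ℓ (⟦ φ ⟧⁻¹ x)) ⟩
    ℤ.- a ℤ.+ (a ℤ.+ ℓ (⟦ φ ⟧⁻¹ x))    ≈⟨ +-congˡ (ℤ.- a) (ℓ-⟦⟧ aff (⟦ φ ⟧⁻¹ x)) ⟨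
    ℤ.- a ℤ.+ ℓ (⟦ φ ⟧ (⟦ φ ⟧⁻¹ x))    ≡⟨ cong (λ y → ℤ.- a ℤ.+ ℓ y) (⟦⟧-inverseˡ φ x) ⟩
    ℤ.- a ℤ.+ ℓ x                      ∎
    where
    open +-*-Solver using (solve; _:+_; :-_; _:=_)
    open SetoidReasoning ≡ₘ-setoid
  Affine-⁻¹ {φ} {a} {true} aff = affine λ x → begin
    ℓ (⟦ φ ⟧⁻¹ x)                      ≡⟨ solve 2 (λ a y → y := a :- (a :- y)) refl a (ℓ (⟦ φ ⟧⁻¹ x)) ⟩
    a ℤ.- (a ℤ.- ℓ (⟦ φ ⟧⁻¹ x))        ≈⟨ +-congˡ a (-‿cong (ℓ-⟦⟧ aff (⟦ φ ⟧⁻¹ x))) ⟨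
    a ℤ.- ℓ (⟦ φ ⟧ (⟦ φ ⟧⁻¹ x))        ≡⟨ cong (λ y → a ℤ.- ℓ y) (⟦⟧-inverseˡ φ x) ⟩
    a ℤ.- ℓ x                          ∎
    where
    open +-*-Solver using (solve; _:-_; _:=_)
    open SetoidReasoning ≡ₘ-setoid

  rotation-affine : Affine rotation (+ 1) false
  rotation-affine = affine λ x → ≡ₘ-trans (ℓ-ρ x) (≡⇒≡ₘ (ZP.+-comm (ℓ x) (+ 1)))

  rotation^ : ℕ → Aut
  rotation^ zero    = G.ε
  rotation^ (suc t) = rotation G.∙ rotation^ t

  rotation^-affine : ∀ t → Affine (rotation^ t) (+ t) false
  rotation^-affine zero    = Affine-ε
  rotation^-affine (suc t) = Affine-∙ rotation-affine (rotation^-affine t)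

  orientation-reflection : orientation reflection ≡ true
  orientation-reflection = dec-true (τ (ρ p₀) ≟ᵥ ρ⁻¹ (τ p₀))
    (sym (trans (ρ⁻¹≡τ∘ρ∘τ (τ p₀)) (cong (τ ∘ ρ) (τ-involutive p₀))))

  reflection-affine : Affine reflection (ℓ (τ p₀)) true
  reflection-affine =
    subst (Affine reflection (ℓ (τ p₀))) orientation-reflection (automorphism-affine reflection)

  D-∙ : ∀ a b c d → (a , b) D.∙ (c , d) ≡ (a ℤ.+ negateIf b c , b xor d)
  D-∙ a false c d = refl
  D-∙ a true  c d = refl

  D-⁻¹ : ∀ a b → (a , b) D.⁻¹ ≡ (negateIf (not b) a , b)
  D-⁻¹ a false = refl
  D-⁻¹ a true  = refl

  Φ : Aut → ℤ × Bool
  Φ φ = ℓ (⟦ φ ⟧ p₀) , orientation φ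

  Φ-affine : ∀ {φ a e} → Affine φ a e → Φ φ D.≈ (a , e)
  Φ-affine aff = ≡ₘ⇒≡[] (Affine-p₀ aff) , sym (Affine-orientation aff)

  Φ-∙ : ∀ φ ψ → Φ (φ G.∙ ψ) D.≈ (Φ φ D.∙ Φ ψ)
  Φ-∙ φ ψ = subst (Φ (φ G.∙ ψ) D.≈_) (sym (D-∙ _ (orientation φ) _ (orientation ψ)))
                  (Φ-affine (Affine-∙ (automorphism-affine φ) (automorphism-affine ψ)))

  Φ-⁻¹ : ∀ φ → Φ (φ G.⁻¹) D.≈ (Φ φ D.⁻¹)
  Φ-⁻¹ φ = subst (Φ (φ G.⁻¹) D.≈_) (sym (D-⁻¹ _ (orientation φ)))
                 (Φ-affine (Affine-⁻¹ (automorphism-affine φ)))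

  Φ-injective : ∀ φ ψ → Φ φ D.≈ Φ ψ → φ G.≈ ψ
  Φ-injective φ ψ (φp₀≡ψp₀ , same-orientation) = Affine-unique
    (subst (Affine φ (ℓ (⟦ ψ ⟧ p₀))) same-orientation (Affine-cong (≡[]⇒≡ₘ φp₀≡ψp₀) (automorphism-affine φ)))
    (automorphism-affine ψ)

  Φ-surjective : ∀ y → Σ Aut λ φ → ∀ {ψ} → ψ G.≈ φ → Φ ψ D.≈ y
  Φ-surjective (a , false) = rotation^ t , λ {ψ} ψ≈ →
    Φ-affine (Affine-≈ ψ ψ≈ (Affine-cong (%ℕ-≡ₘ a) (rotation^-affine t)))
    where
    t : ℕ
    t = a %ℕ m
  Φ-surjective (a , true)  = rotation^ t G.∙ reflection , λ {ψ} ψ≈ →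
    Φ-affine (Affine-≈ ψ ψ≈ (Affine-cong t+k≡a (Affine-∙ (rotation^-affine t) reflection-affine)))
    where
    open +-*-Solver using (solve; _:+_; _:-_; _:=_)
    k : ℤ
    k = ℓ (τ p₀)
    t : ℕ
    t = (a ℤ.- k) %ℕ m
    t+k≡a : + t ℤ.+ k ≡ₘ a
    t+k≡a = ≡ₘ-trans (+-cong (%ℕ-≡ₘ (a ℤ.- k)) ≡ₘ-refl) (≡⇒≡ₘ (solve 2 (λ a k → (a :- k) :+ k := a) refl a k))

  Aut≅Dihedral : G ≅ᴳ D
  Aut≅Dihedral = Φ , record
    { isGroupMonomorphism = record
      { isGroupHomomorphism = record
        { isMonoidHomomorphism = record
          { isMagmaHomomorphism = record
            { isRelHomomorphism = record
              { cong = λ {φ} {ψ} φ≈ψ → Φ-affine (Affine-≈ φ φ≈ψ (automorphism-affine ψ)) }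
            ; homo = Φ-∙
            }
          ; ε-homo = Φ-affine Affine-ε
          }
        ; ⁻¹-homo = Φ-⁻¹
        }
      ; injective = λ {φ} {ψ} → Φ-injective φ ψ
      }
    ; surjective = Φ-surjective
    }

-- Two columns: n disjoint edges

flipIf : Bool → Fin 2 → Fin 2
flipIf false b  = b
flipIf true  0F = 1F
flipIf true  1F = 0F

flipIf-xor : ∀ e d b → flipIf e (flipIf d b) ≡ flipIf (e xor d) b
flipIf-xor false d     b  = refl
flipIf-xor true  false b  = refl
flipIf-xor true  true  0F = refl
flipIf-xor true  true  1F = refl

flipIf-involutive : ∀ e b → flipIf e (flipIf e b) ≡ b
flipIf-involutive e b = trans (flipIf-xor e e b) (cong (λ d → flipIf d b) (BP.xor-same e))

flipIf-0F : ∀ c → flipIf (Inverse.to FP.2↔Bool c) 0F ≡ c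
flipIf-0F 0F = refl
flipIf-0F 1F = refl

to-flipIf-0F : ∀ e → Inverse.to FP.2↔Bool (flipIf e 0F) ≡ e
to-flipIf-0F false = refl
to-flipIf-0F true  = refl

flipIf-1F : ∀ c → flipIf (Inverse.to FP.2↔Bool c) 1F ≡ flipIf true c
flipIf-1F 0F = refl
flipIf-1F 1F = refl

≢⇒flip : ∀ {b c : Fin 2} → b ≢ c → b ≡ flipIf true c
≢⇒flip {0F} {0F} b≢c = ⊥-elim (b≢c refl)
≢⇒flip {0F} {1F} _   = refl
≢⇒flip {1F} {0F} _   = refl
≢⇒flip {1F} {1F} b≢c = ⊥-elim (b≢c refl)

Step₂-total : (j l : Fin 2) → Step j l
Step₂-total 0F 0F = inj₁ refl
Step₂-total 1F 1F = inj₁ refl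
Step₂-total 0F 1F = inj₂ refl
Step₂-total 1F 0F = inj₂ refl

module TwoColumns (N : ℕ) where

  Vtx₂ : Set
  Vtx₂ = Vertex (suc N) 2

  Aut₂ : Set
  Aut₂ = Automorphism (suc N) 2

  G W : RawGroup 0ℓ 0ℓ
  G = AutGroup (suc N) 2
  W = Wreath (suc N)
  module G = RawGroup G
  module W = RawGroup W

  NonAdj₂-intro : ∀ {i j k l} → (i ≡ k → j ≡ l) → NonAdj {suc N} {1} (i , j) (k , l)
  NonAdj₂-intro {i} {j} {k} {l} same-row⇒same-column with NP.<-cmp (toℕ i) (toℕ k)
  ... | tri< i<k _ _ = inj₂ (inj₁ (i<k , Step₂-total j l))
  ... | tri≈ _ i≡k _ = inj₁ (FP.toℕ-injective i≡k , same-row⇒same-column (FP.toℕ-injective i≡k))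
  ... | tri> _ _ k<i = inj₂ (inj₂ (k<i , Step₂-total l j))

  NonAdj₂-elim : ∀ {i j k l} → NonAdj {suc N} {1} (i , j) (k , l) → i ≡ k → j ≡ l
  NonAdj₂-elim (inj₁ (_ , j≡l))          _    = j≡l
  NonAdj₂-elim (inj₂ (inj₁ (i<i , _))) refl = ⊥-elim (NP.<-irrefl refl i<i)
  NonAdj₂-elim (inj₂ (inj₂ (i<i , _))) refl = ⊥-elim (NP.<-irrefl refl i<i)

  Adj₂⇒same-row : ∀ {i j k l} → Adj (suc N) 2 (i , j) (k , l) → i ≡ k
  Adj₂⇒same-row {i} {k = k} adj with i FP.≟ k
  ... | yes i≡k = i≡k
  ... | no  i≢k = ⊥-elim (NonAdj⇒¬Adj _ _ (NonAdj₂-intro (⊥-elim ∘ i≢k)) adj)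

  wreathAction : W.Carrier → Vtx₂ → Vtx₂
  wreathAction (f , σ) (i , b) = σ ⟨$⟩ʳ i , flipIf (f (σ ⟨$⟩ʳ i)) b

  wreathAction-cong : ∀ {w w′} → w W.≈ w′ → ∀ x → wreathAction w x ≡ wreathAction w′ x
  wreathAction-cong {f , σ} {g , τ} (f≗g , σ≗τ) (i , b) =
    cong₂ _,_ (σ≗τ i) (cong (λ k → flipIf k b) (trans (f≗g (σ ⟨$⟩ʳ i)) (cong g (σ≗τ i))))

  wreathAction-∙ : ∀ w w′ x → wreathAction w (wreathAction w′ x) ≡ wreathAction (w W.∙ w′) x
  wreathAction-∙ (f , σ) (g , τ) (i , b) = cong (σ ⟨$⟩ʳ (τ ⟨$⟩ʳ i) ,_) (begin
    flipIf (f k) (flipIf (g (τ ⟨$⟩ʳ i)) b)            ≡⟨ flipIf-xor (f k) _ b ⟩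
    flipIf (f k xor g (τ ⟨$⟩ʳ i)) b                   ≡⟨ cong (λ j → flipIf (f k xor g j) b) (P.inverseˡ σ) ⟨
    flipIf (f k xor g (σ ⟨$⟩ˡ k)) b                   ∎)
    where
    open ≡-Reasoning
    k : Fin (suc N)
    k = σ ⟨$⟩ʳ (τ ⟨$⟩ʳ i)

  wreathAction-inverseˡ : ∀ w x → wreathAction w (wreathAction (w W.⁻¹) x) ≡ x
  wreathAction-inverseˡ (f , σ) (k , c) = cong₂ _,_ (P.inverseʳ σ)
    (trans (cong (λ j → flipIf (f j) (flipIf (f (σ ⟨$⟩ʳ (σ ⟨$⟩ˡ k))) c)) (P.inverseʳ σ))
           (trans (cong (λ j → flipIf (f k) (flipIf (f j) c)) (P.inverseʳ σ)) (flipIf-involutive (f k) c)))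

  wreathAction-inverseʳ : ∀ w x → wreathAction (w W.⁻¹) (wreathAction w x) ≡ x
  wreathAction-inverseʳ (f , σ) (i , b) = cong₂ _,_ (P.inverseˡ σ)
    (trans (cong (λ j → flipIf (f (σ ⟨$⟩ʳ j)) (flipIf (f (σ ⟨$⟩ʳ i)) b)) (P.inverseˡ σ))
           (flipIf-involutive (f (σ ⟨$⟩ʳ i)) b))

  wreathAction-NonAdj : ∀ w x y → NonAdj x y → NonAdj (wreathAction w x) (wreathAction w y)
  wreathAction-NonAdj (f , σ) (i , j) (k , l) x≁y = NonAdj₂-intro λ σi≡σk →
    let i≡k = trans (sym (P.inverseˡ σ)) (trans (cong (σ ⟨$⟩ˡ_) σi≡σk) (P.inverseˡ σ)) in
    cong₂ (λ u c → flipIf (f (σ ⟨$⟩ʳ u)) c) i≡k (NonAdj₂-elim x≁y i≡k)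

  wreath-automorphism : W.Carrier → Aut₂
  wreath-automorphism w = automorphism (wreathAction w) (wreathAction (w W.⁻¹))
    (wreathAction-inverseˡ w) (wreathAction-inverseʳ w)
    (wreathAction-NonAdj w) (wreathAction-NonAdj (w W.⁻¹))

  row : Aut₂ → Fin (suc N) → Fin (suc N)
  row φ i = proj₁ (⟦ φ ⟧ (i , 0F))

  row-⟦⟧ : ∀ φ i b → proj₁ (⟦ φ ⟧ (i , b)) ≡ row φ i
  row-⟦⟧ φ i 0F = refl
  row-⟦⟧ φ i 1F = sym (Adj₂⇒same-row (proj₁ (preserve φ (i , 0F) (i , 1F)) (inj₁ (refl , λ ()))))

  row-inverseˡ : ∀ φ k → row φ (row (φ G.⁻¹) k) ≡ k
  row-inverseˡ φ k =
    trans (sym (row-⟦⟧ φ _ (proj₂ (⟦ φ ⟧⁻¹ (k , 0F))))) (cong proj₁ (⟦⟧-inverseˡ φ (k , 0F)))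

  row-inverseʳ : ∀ φ i → row (φ G.⁻¹) (row φ i) ≡ i
  row-inverseʳ φ i =
    trans (sym (row-⟦⟧ (φ G.⁻¹) _ (proj₂ (⟦ φ ⟧ (i , 0F))))) (cong proj₁ (⟦⟧-inverseʳ φ (i , 0F)))

  Ψ : Aut₂ → W.Carrier
  Ψ φ = flips , mk↔ₛ′ (row φ) (row (φ G.⁻¹)) (row-inverseˡ φ) (row-inverseʳ φ)
    where
    flips : Fin (suc N) → Bool
    flips k = Inverse.to FP.2↔Bool (proj₂ (⟦ φ ⟧ (row (φ G.⁻¹) k , 0F)))

  ⟦⟧≡wreathAction : ∀ φ x → ⟦ φ ⟧ x ≡ wreathAction (Ψ φ) x
  ⟦⟧≡wreathAction φ (i , b) = cong₂ _,_ (row-⟦⟧ φ i b) (trans (column b)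
    (cong (λ u → flipIf (Inverse.to FP.2↔Bool (proj₂ (⟦ φ ⟧ (u , 0F)))) b) (sym (row-inverseʳ φ i))))
    where
    c₀ : Fin 2
    c₀ = proj₂ (⟦ φ ⟧ (i , 0F))
    column : ∀ b → proj₂ (⟦ φ ⟧ (i , b)) ≡ flipIf (Inverse.to FP.2↔Bool c₀) b
    column 0F = sym (flipIf-0F c₀)
    column 1F = trans (≢⇒flip λ c₁≡c₀ → 1F≢0F (⟦⟧-injective φ (cong₂ _,_ (row-⟦⟧ φ i 1F) c₁≡c₀)))
                      (sym (flipIf-1F c₀))
      where
      1F≢0F : (i , 1F) ≢ (i , 0F)
      1F≢0F ()

  Ψ-unique : ∀ χ w → (∀ x → ⟦ χ ⟧ x ≡ wreathAction w x) → Ψ χ W.≈ w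
  Ψ-unique χ (g , π) χ≗w = same-flips , same-rows
    where
    same-rows : ∀ i → row χ i ≡ π ⟨$⟩ʳ i
    same-rows i = cong proj₁ (χ≗w (i , 0F))
    same-flips : ∀ k → proj₁ (Ψ χ) k ≡ g k
    same-flips k = trans (cong (Inverse.to FP.2↔Bool ∘ proj₂) (χ≗w (row (χ G.⁻¹) k , 0F)))
                         (trans (to-flipIf-0F _) (cong g (trans (sym (same-rows _)) (row-inverseˡ χ k))))

  Ψ-⁻¹ : ∀ φ x → ⟦ φ ⟧⁻¹ x ≡ wreathAction (Ψ φ W.⁻¹) x
  Ψ-⁻¹ φ x = begin
    ⟦ φ ⟧⁻¹ x                                                ≡⟨ cong ⟦ φ ⟧⁻¹ (wreathAction-inverseˡ (Ψ φ) x) ⟨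
    ⟦ φ ⟧⁻¹ (wreathAction (Ψ φ) (wreathAction (Ψ φ W.⁻¹) x)) ≡⟨ cong ⟦ φ ⟧⁻¹ (⟦⟧≡wreathAction φ _) ⟨
    ⟦ φ ⟧⁻¹ (⟦ φ ⟧ (wreathAction (Ψ φ W.⁻¹) x))              ≡⟨ ⟦⟧-inverseʳ φ _ ⟩
    wreathAction (Ψ φ W.⁻¹) x                                ∎
    where open ≡-Reasoning

  Aut≅Wreath : G ≅ᴳ W
  Aut≅Wreath = Ψ , record
    { isGroupMonomorphism = record
      { isGroupHomomorphism = record
        { isMonoidHomomorphism = record
          { isMagmaHomomorphism = record
            { isRelHomomorphism = record
              { cong = λ {φ} {ψ} φ≈ψ → Ψ-unique φ (Ψ ψ) λ x → trans (φ≈ψ x) (⟦⟧≡wreathAction ψ x) }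
            ; homo = λ φ ψ → Ψ-unique (φ G.∙ ψ) (Ψ φ W.∙ Ψ ψ) λ x →
                trans (cong ⟦ φ ⟧ (⟦⟧≡wreathAction ψ x))
                      (trans (⟦⟧≡wreathAction φ _) (wreathAction-∙ (Ψ φ) (Ψ ψ) x))
            }
          ; ε-homo = Ψ-unique G.ε W.ε λ _ → refl
          }
        ; ⁻¹-homo = λ φ → Ψ-unique (φ G.⁻¹) (Ψ φ W.⁻¹) (Ψ-⁻¹ φ)
        }
      ; injective = λ {φ} {ψ} Ψφ≈Ψψ x → trans (⟦⟧≡wreathAction φ x)
          (trans (wreathAction-cong {Ψ φ} {Ψ ψ} Ψφ≈Ψψ x) (sym (⟦⟧≡wreathAction ψ x)))
      }
    ; surjective = λ w → wreath-automorphism w , λ {χ} χ≈ → Ψ-unique χ w χ≈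
    }

proposition2p5 : (n v : ℕ) → 2 ≤ n → 2 ≤ v →
                 (v ≡ 2 → AutGroup n v ≅ᴳ Wreath n)
                 × (3 ≤ v → AutGroup n v ≅ᴳ Dihedral (n * v))
proposition2p5 (suc N) (suc V) (s≤s 1≤N) (s≤s _) = two-columns , more-columns
  where
  two-columns : suc V ≡ 2 → AutGroup (suc N) (suc V) ≅ᴳ Wreath (suc N)
  two-columns refl = TwoColumns.Aut≅Wreath N
  more-columns : 3 ≤ suc V → AutGroup (suc N) (suc V) ≅ᴳ Dihedral (suc N * suc V)
  more-columns (s≤s 2≤V) = DihedralIsomorphism.Aut≅Dihedral N V 1≤N 2≤V
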